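{- Let $m\geqslant4$ and let $H$, $x$, $y$, $z$, $R$ and $\Gamma_m$ be as in the context. Let $\mathrm{Alt}(H^*)$ denote the subgroup of $\mathrm{Alt}(H)$ consisting of even permutations fixing $1$ (equivalently the alternating group on $H^*=H\setminus\{1\}$). Then $\mathrm{Cay}(\mathrm{Alt}(H^*),\{x,y,z\})$ is a nonnormal Cayley graph of $\mathrm{Alt}(H^*)$, and it is isomorphic to $\Gamma_m$ via the map $g\mapsto R(H)g$.
   Context: Permutations act on the right, written exponentially, and a product $\sigma\rho$ means first $\sigma$ then $\rho$. $\mathrm{Alt}(H)$ is the alternating group on the set $H$. For a group $G$ and inverse-closed $S\subseteq G\setminus\{1\}$, $\mathrm{Cay}(G,S)$ has vertex set $G$ with $g_1\sim g_2$ iff $g_2g_1^{ -1}\in S$; it is normal if the right regular representation of $G$ is normal in its full automorphism group, and nonnormal otherwise. For a group $G$, a subgroup $L$ and a subset $S$ with $S\cap L=\emptyset$ and $LSL$ inverse-closed, $\mathrm{Cos}(G,L,LSL)$ has vertex set the right cosets of $L$ in $G$ and edges $\{Lg,Lsg\}$ for $g\in G$, $s\in LSL$. Let $m\geqslant4$ and $H=\langle a,b\mid a^4=b^2=(ab)^2=1\rangle\times\langle c_1\rangle\times\cdots\times\langle c_{m-3}\rangle$, where $c_1,\dots,c_{m-3}$ are involutions. Put $c_{ -1}=c_0=1$. Let $K=\langle a^2,b,c_1,\dots,c_{m-3}\rangle$ and $h=a\prod_{i=0}^{\lceil(m-5)/2\rceil}c_{2i+1}$. Let $x\in\mathrm{Aut}(H)$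 be defined by $a^x=a^{ -1}$, $b^x=ab$, $c_{2i+1}^x=c_{2i+1}$, $c_{2i+2}^x=a^2c_{2i+1}c_{2i+2}$ for $0\leqslant i\leqslant\lfloor(m-5)/2\rfloor$, and additionally $c_{m-3}^x=a^2c_{m-3}$ if $m$ is even. Let $\tau\in\mathrm{Aut}(K)$ be defined by $(a^2)^\tau=b$, $b^\tau=a^2$, $c_{2i+1}^\tau=c_{2i-1}c_{2i}c_{2i+2}$, $c_{2i+2}^\tau=c_{2i-1}c_{2i}c_{2i+1}$ for $0\leqslant i\leqslant\lfloor(m-5)/2\rfloor$, and additionally $c_{m-3}^\tau=c_{m-3}$ if $m$ is even. Let $R$ be the right regular representation of $H$ ($R(g):u\mapsto ug$). Let $y$ be the permutation of $H$ with $k^y=k^\tau$ and $(hk)^y=hk^\tau$ if $m$ is odd, $(hk)^y=hk^\tau c_{m-3}$ if $m$ is even, for all $k\in K$. Let $z=R(h)yR(h^{ -1})$ if $m$ is odd and $z=R(h)yR(h^{ -1}c_{m-3})$ if $m$ is even. (Then $x,y,z$ are involutions in $\mathrm{Alt}(H)$ fixing $1$.) Let $\Gamma_m=\mathrm{Cos}(\mathrm{Alt}(H),R(H),R(H)\{x,y\}R(H))$. -}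

module Defs where

open import Data.Nat using (ℕ; zero; suc; _+_; _∸_; _≡ᵇ_; _%_; ⌊_/2⌋)
open import Data.Nat.DivMod using (m%n<n)
open import Data.Fin using (Fin; toℕ; fromℕ<)
import Data.Fin as F
open import Data.Bool using (Bool; true; false; if_then_else_; _xor_; not; _∧_)
import Data.Bool as B
open import Data.Vec using (Vec; []; _∷_; zipWith; replicate; tabulate)
import Data.Vec.Properties as VP
import Data.Product.Properties as PP
open import Data.Product using (Σ; Σ-syntax; _×_; _,_; proj₁; proj₂; ∃; ∃-syntax)
open import Data.Sum using (_⊎_)
open import Data.List using (List; []; _∷_; _++_)
open import Relation.Binary.PropositionalEquality
open import Relation.Nullary using (¬_; does)
open import Relation.Binary.Definitions using (DecidableEquality)

-- Permutations of a set, as functions, acting on the right.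
-- (σ ·ₚ ρ) means "first σ, then ρ":  u^(σρ) = (u^σ)^ρ.

_·ₚ_ : {A : Set} → (A → A) → (A → A) → (A → A)
(σ ·ₚ ρ) u = ρ (σ u)

_≈ₚ_ : {A : Set} → (A → A) → (A → A) → Set
σ ≈ₚ ρ = ∀ u → σ u ≡ ρ u

module _ {A : Set} (_≟_ : DecidableEquality A) where

  swap : A → A → A → A
  swap u v w = if does (w ≟ u) then v else (if does (w ≟ v) then u else w)

  Transposition : Set
  Transposition = Σ[ u ∈ A ] Σ[ v ∈ A ] u ≢ v

  applyT : Transposition → A → A
  applyT (u , v , _) = swap u v

  applyPairs : List (Transposition × Transposition) → A → A
  applyPairs []              w = w
  applyPairs ((s , t) ∷ ps) w = applyPairs ps (applyT t (applyT s w))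

  IsEven : (A → A) → Set
  IsEven σ = Σ[ ps ∈ List (Transposition × Transposition) ] σ ≈ₚ applyPairs ps

  applyPairs-++ : ∀ ps qs w → applyPairs (ps ++ qs) w ≡ applyPairs qs (applyPairs ps w)
  applyPairs-++ []             qs w = refl
  applyPairs-++ ((s , t) ∷ ps) qs w = applyPairs-++ ps qs (applyT t (applyT s w))

  even-· : ∀ {σ ρ} → IsEven σ → IsEven ρ → IsEven (σ ·ₚ ρ)
  even-· {σ} {ρ} (ps , eσ) (qs , eρ) = ps ++ qs , λ w →
    trans (eρ (σ w)) (trans (cong (applyPairs qs) (eσ w)) (sym (applyPairs-++ ps qs w)))

-- Graph-theoretic notions for graphs whose vertex set carries an
-- equality relation _≈_ (vertices are permutations / cosets).

record IsAutomorphism {V : Set} (_≈_ : V → V → Set) (Adj : V → V → Set)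
                      (φ φ⁻¹ : V → V) : Set where
  field
    cong-φ   : ∀ {u v} → u ≈ v → φ u ≈ φ v
    cong-φ⁻¹ : ∀ {u v} → u ≈ v → φ⁻¹ u ≈ φ⁻¹ v
    inverseˡ : ∀ v → φ (φ⁻¹ v) ≈ v
    inverseʳ : ∀ v → φ⁻¹ (φ v) ≈ v
    adj-to   : ∀ u v → Adj u v → Adj (φ u) (φ v)
    adj-from : ∀ u v → Adj (φ u) (φ v) → Adj u v

record IsGraphIso {V W : Set} (_≈V_ : V → V → Set) (_≈W_ : W → W → Set)
                  (AdjV : V → V → Set) (AdjW : W → W → Set) (f : V → W) : Set where
  field
    well-defined : ∀ {u v} → u ≈V v → f u ≈W f v
    injective    : ∀ {u v} → f u ≈W f v → u ≈V v
    surjective   : ∀ w → ∃[ v ] (f v ≈W w)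
    adj-to       : ∀ u v → AdjV u v → AdjW (f u) (f v)
    adj-from     : ∀ u v → AdjW (f u) (f v) → AdjV u v

-- The group H = D₈ × C₂^(m-3),  D₈ = ⟨a,b | a⁴ = b² = (ab)² = 1⟩.
-- An element (i , j , v) stands for a^i b^j c₁^(v₁) ⋯ c_{m-3}^(v_{m-3}).

Z4 : Set
Z4 = Fin 4

_+₄_ : Z4 → Z4 → Z4
i +₄ j = fromℕ< (m%n<n (toℕ i + toℕ j) 4)

-₄_ : Z4 → Z4
-₄ i = fromℕ< (m%n<n (4 ∸ toℕ i) 4)

isEvenℕ : ℕ → Bool
isEvenℕ zero    = true
isEvenℕ (suc n) = not (isEvenℕ n)

module _ (m : ℕ) where

  H : Set
  H = Z4 × Bool × Vec Bool (m ∸ 3)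

  _≟H_ : DecidableEquality H
  _≟H_ = PP.≡-dec F._≟_ (PP.≡-dec B._≟_ (VP.≡-dec B._≟_))

  -- multiplication, using b a^k = a^(-k) b
  _·_ : H → H → H
  (i , j , v) · (k , l , w) = (i +₄ (if j then -₄ k else k)) , (j xor l) , zipWith _xor_ v w

  e : H
  e = F.zero , false , replicate (m ∸ 3) false

  inv : H → H
  inv (i , false , v) = (-₄ i) , false , v
  inv (i , true  , v) = i , true , v

  pow : H → ℕ → H
  pow g zero    = e
  pow g (suc n) = g · pow g n

  a b : H
  a = F.suc F.zero , false , replicate (m ∸ 3) false
  b = F.zero , true , replicate (m ∸ 3) false

  a² : H
  a² = a · a

  -- c k is the generator c_k for 1 ≤ k ≤ m-3; c 0 = 1 (this also encodes
  -- the convention c_{-1} = c_0 = 1, since natural subtraction truncates)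
  c : ℕ → H
  c k = F.zero , false , tabulate (λ i → suc (toℕ i) ≡ᵇ k)

  prodFrom : (ℕ → H) → ℕ → {n : ℕ} → Vec Bool n → H
  prodFrom C s []            = e
  prodFrom C s (true  ∷ vs)  = C s · prodFrom C (suc s) vs
  prodFrom C s (false ∷ vs)  = prodFrom C (suc s) vs

  prodUpTo : (ℕ → H) → ℕ → H
  prodUpTo f zero    = f 0
  prodUpTo f (suc N) = prodUpTo f N · f (suc N)

  extend : H → H → (ℕ → H) → H → H
  extend A B C (i , j , v) = pow A (toℕ i) · (pow B (if j then 1 else 0) · prodFrom C 1 v)

  mEven : Bool
  mEven = isEvenℕ m

  -- true iff k = m-3 and m is even (the extra generator in the even case)
  isLast : ℕ → Bool
  isLast k = mEven ∧ (k ≡ᵇ (m ∸ 3))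

  xc : ℕ → H
  xc k = if isLast k then a² · c k
         else (if isEvenℕ k then a² · (c (k ∸ 1) · c k) else c k)

  x : H → H
  x = extend (pow a 3) (a · b) xc

  -- K = ⟨a², b, c_1, …, c_{m-3}⟩  (a-exponent even)
  inK : H → Bool
  inK (i , _ , _) = isEvenℕ (toℕ i)

  τc : ℕ → H
  τc k = if isLast k then c k
         else (if isEvenℕ k then c (k ∸ 3) · (c (k ∸ 2) · c (k ∸ 1))
                            else c (k ∸ 2) · (c (k ∸ 1) · c (suc k)))

  -- the automorphism τ of K (applied to a^(2e) b^j c^v):
  -- (a²)^e b^j c^v ↦ b^e (a²)^j ∏ (c_k^τ)^(v_k)
  τ : H → H
  τ (i , j , v) = pow b ⌊ toℕ i /2⌋ · (pow a² (if j then 1 else 0) · prodFrom τc 1 v)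

  -- h = a ∏_{i=0}^{⌈(m-5)/2⌉} c_{2i+1};  for m ≥ 4, ⌈(m-5)/2⌉ = ⌊(m-4)/2⌋
  h : H
  h = a · prodUpTo (λ i → c (suc (i + i))) ⌊ m ∸ 4 /2⌋

  cLast : H
  cLast = if mEven then c (m ∸ 3) else e

  R : H → H → H
  R g u = u · g

  y : H → H
  y u = if inK u then τ u else h · (τ (inv h · u) · cLast)

  z : H → H
  z = (R h ·ₚ y) ·ₚ R (inv h · cLast)

  EvenH : (H → H) → Set
  EvenH = IsEven _≟H_

  AltH : Set
  AltH = Σ[ g ∈ (H → H) ] EvenH g

  AltH* : Set
  AltH* = Σ[ g ∈ (H → H) ] (EvenH g × g e ≡ e)

  _≈*_ : AltH* → AltH* → Set
  g ≈* g′ = proj₁ g ≈ₚ proj₁ g′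

  InS : (H → H) → Set
  InS s = (s ≈ₚ x) ⊎ (s ≈ₚ y) ⊎ (s ≈ₚ z)

  -- Cay(Alt(H*), S):  g₁ ~ g₂  iff  g₂ g₁⁻¹ ∈ S, i.e. g₂ = s g₁ for some s ∈ S
  CayAdj : AltH* → AltH* → Set
  CayAdj g₁ g₂ = Σ[ s ∈ (H → H) ] (InS s × (proj₁ g₂ ≈ₚ (s ·ₚ proj₁ g₁)))

  ρ : AltH* → AltH* → AltH*
  ρ (g , eg , fg) (v , ev , fv) = (v ·ₚ g) , even-· _≟H_ ev eg , trans (cong g fv) fg

  -- Cay(Alt(H*), S) is normal: ρ(Alt(H*)) is normal in Aut(Cay(Alt(H*), S))
  IsNormalCay : Set
  IsNormalCay = ∀ (φ φ⁻¹ : AltH* → AltH*) → IsAutomorphism _≈*_ CayAdj φ φ⁻¹ →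
                ∀ g → ∃[ g′ ] (∀ v → φ (ρ g (φ⁻¹ v)) ≈* ρ g′ v)

  -- Γ_m = Cos(Alt(H), R(H), R(H){x,y}R(H))

  SameCoset : (H → H) → (H → H) → Set
  SameCoset f f′ = Σ[ k ∈ H ] (f′ ≈ₚ (R k ·ₚ f))

  InLSL : (H → H) → Set
  InLSL s = Σ[ k₁ ∈ H ] Σ[ k₂ ∈ H ] Σ[ t ∈ (H → H) ] (((t ≈ₚ x) ⊎ (t ≈ₚ y)) × (s ≈ₚ ((R k₁ ·ₚ t) ·ₚ R k₂)))

  -- vertices: right cosets R(H)g (g ∈ Alt(H)), represented by g
  _≈Γ_ : AltH → AltH → Set
  A ≈Γ A′ = SameCoset (proj₁ A) (proj₁ A′)

  ΓAdj : AltH → AltH → Set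
  ΓAdj A B = Σ[ g ∈ AltH ] Σ[ s ∈ (H → H) ] (InLSL s ×
              ((SameCoset (proj₁ A) (proj₁ g) × SameCoset (proj₁ B) (s ·ₚ proj₁ g))
               ⊎ (SameCoset (proj₁ B) (proj₁ g) × SameCoset (proj₁ A) (s ·ₚ proj₁ g))))

  toCoset : AltH* → AltH
  toCoset (g , eg , _) = g , eg

-- The argument turns on one property of S = {x, y, z}: each s ∈ S is an involution fixing 1,
-- and for every q ∈ H the map w ↦ s(wq)·s(q)⁻¹ again lies in S. For x this holds because x is
-- an automorphism; y is the automorphism τ of the index-2 subgroup K, transported by h to the
-- coset hK, and translating by an element outside K exchanges y and z.
-- Normalising the coset representatives of an edge {R(H)g, R(H)sg} of Γ_m to fix 1, this
-- property turns it into an edge of the Cayley graph, so g ↦ R(H)g is an isomorphism. The same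
-- property makes V ↦ R(k) V R(a²), where V(k) = a², an automorphism of the Cayley graph, and
-- evaluating it on two 3-cycles of the copy of D₈ in H shows that it does not normalise the
-- right regular representation. The translations R(k) are even since H consists of two copies
-- of a group of the same shape with one factor C₂ fewer; statements about D₈ alone are decided
-- by exhaustive computation.

module Submission where

open import Defs
open import Data.Nat using (ℕ; zero; suc; _+_; _∸_; _≤_; _<_; z≤n; s≤s; _≡ᵇ_; ⌊_/2⌋)
import Data.Nat.Properties as ℕ
open import Level using (0ℓ)
open import Algebra.Bundles using (Group)
open import Algebra.Structures using (IsGroup)
import Algebra.Properties.Group as GroupProperties
open import Data.Fin using (Fin; toℕ)
import Data.Fin as F
open import Data.Fin.Properties using (all?)
open import Data.Bool using (Bool; true; false; not; _∧_; _xor_; if_then_else_; T)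
import Data.Bool as Bool
open import Data.Bool.Properties using (not-distribʳ-xor; not-involutive; not-injective; ∧-zeroʳ; ∧-identityʳ; xor-comm; xor-identityˡ; xor-identityʳ; xor-assoc; xor-same)
open import Data.Vec using (Vec; []; _∷_; zipWith; replicate; tabulate)
import Data.Vec.Properties as Vec
import Data.Product.Properties as Product
open import Data.Product using (Σ; _×_; _,_; proj₁; proj₂; ∃; ∃₂)
open import Data.Sum using (_⊎_; inj₁; inj₂)
open import Data.List using (List; []; _∷_; _++_; cartesianProductWith; allFin)
open import Data.Empty using (⊥-elim)
open import Data.Unit using (⊤; tt)
open import Function using (_∘_; Injective; case_of_)
open import Relation.Binary.PropositionalEquality
open import Relation.Binary.Definitions using (DecidableEquality)
open import Relation.Nullary using (¬_; Dec; yes; no; does)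
open import Relation.Nullary.Decidable using (True; toWitness; map′; _×-dec_; _→-dec_; dec-true; dec-false)

Decidable∀ : Set → Set₁
Decidable∀ A = {P : A → Set} → (∀ a → Dec (P a)) → Dec (∀ a → P a)

∀-Bool? : Decidable∀ Bool
∀-Bool? P? = map′ (λ (p , q) → λ { false → p ; true → q }) (λ f → f false , f true) (P? false ×-dec P? true)

∀-⊤? : Decidable∀ ⊤
∀-⊤? P? = map′ (λ p _ → p) (λ f → f tt) (P? tt)

∀-×? : {A B : Set} → Decidable∀ A → Decidable∀ B → Decidable∀ (A × B)
∀-×? A? B? P? = map′ (λ f → λ { (a , b) → f a b }) (λ f a b → f (a , b)) (A? λ a → B? λ b → P? (a , b))

∀-Vec? : {A : Set} → Decidable∀ A → ∀ n → Decidable∀ (Vec A n)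
∀-Vec? A? zero    P? = map′ (λ p → λ { [] → p }) (λ f → f []) (P? [])
∀-Vec? A? (suc n) P? = map′ (λ f → λ { (a ∷ v) → f a v }) (λ f a v → f (a ∷ v)) (A? λ a → ∀-Vec? A? n λ v → P? (a ∷ v))

module Transpositions {A : Set} (_≟_ : DecidableEquality A) where

  swap-fixes : ∀ u v w → w ≢ u → w ≢ v → swap _≟_ u v w ≡ w
  swap-fixes u v w w≢u w≢v rewrite dec-false (w ≟ u) w≢u | dec-false (w ≟ v) w≢v = refl

  swap-involutive : ∀ u v w → swap _≟_ u v (swap _≟_ u v w) ≡ w
  swap-involutive u v w with w ≟ u
  ... | yes refl rewrite dec-true (v ≟ v) refl with v ≟ w
  ...   | yes v≡w = v≡w
  ...   | no _ = refl
  swap-involutive u v w | no w≢u with w ≟ v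
  ... | yes refl rewrite dec-true (u ≟ u) refl = refl
  ... | no w≢v = swap-fixes u v w w≢u w≢v

  Pairs : Set
  Pairs = List (Transposition _≟_ × Transposition _≟_)

  reversePairs : Pairs → Pairs
  reversePairs []             = []
  reversePairs ((s , t) ∷ ps) = reversePairs ps ++ ((t , s) ∷ [])

  applyT-involutive : ∀ t w → applyT _≟_ t (applyT _≟_ t w) ≡ w
  applyT-involutive (u , v , _) = swap-involutive u v

  reversePairs-inverseˡ : ∀ ps w → applyPairs _≟_ (reversePairs ps) (applyPairs _≟_ ps w) ≡ w
  reversePairs-inverseˡ []             w = refl
  reversePairs-inverseˡ ((s , t) ∷ ps) w = begin
    applyPairs _≟_ (reversePairs ps ++ _) (applyPairs _≟_ ps (applyT _≟_ t (applyT _≟_ s w)))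
      ≡⟨ applyPairs-++ _≟_ (reversePairs ps) _ _ ⟩
    applyT _≟_ s (applyT _≟_ t (applyPairs _≟_ (reversePairs ps) (applyPairs _≟_ ps (applyT _≟_ t (applyT _≟_ s w)))))
      ≡⟨ cong (applyT _≟_ s ∘ applyT _≟_ t) (reversePairs-inverseˡ ps _) ⟩
    applyT _≟_ s (applyT _≟_ t (applyT _≟_ t (applyT _≟_ s w)))
      ≡⟨ cong (applyT _≟_ s) (applyT-involutive t _) ⟩
    applyT _≟_ s (applyT _≟_ s w)
      ≡⟨ applyT-involutive s w ⟩
    w ∎
    where open ≡-Reasoning

  reversePairs-inverseʳ : ∀ ps w → applyPairs _≟_ ps (applyPairs _≟_ (reversePairs ps) w) ≡ w
  reversePairs-inverseʳ []             w = refl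
  reversePairs-inverseʳ ((s , t) ∷ ps) w = begin
    applyPairs _≟_ ps (applyT _≟_ t (applyT _≟_ s (applyPairs _≟_ (reversePairs ps ++ _) w)))
      ≡⟨ cong (applyPairs _≟_ ps ∘ applyT _≟_ t ∘ applyT _≟_ s) (applyPairs-++ _≟_ (reversePairs ps) _ w) ⟩
    applyPairs _≟_ ps (applyT _≟_ t (applyT _≟_ s (applyT _≟_ s (applyT _≟_ t (applyPairs _≟_ (reversePairs ps) w)))))
      ≡⟨ cong (applyPairs _≟_ ps ∘ applyT _≟_ t) (applyT-involutive s _) ⟩
    applyPairs _≟_ ps (applyT _≟_ t (applyT _≟_ t (applyPairs _≟_ (reversePairs ps) w)))
      ≡⟨ cong (applyPairs _≟_ ps) (applyT-involutive t _) ⟩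
    applyPairs _≟_ ps (applyPairs _≟_ (reversePairs ps) w)
      ≡⟨ reversePairs-inverseʳ ps w ⟩
    w ∎
    where open ≡-Reasoning

  even-resp : ∀ {σ σ′} → σ ≈ₚ σ′ → IsEven _≟_ σ → IsEven _≟_ σ′
  even-resp σ≈σ′ (ps , σ≈ps) = ps , λ w → trans (sym (σ≈σ′ w)) (σ≈ps w)

  preimage : ∀ {σ} → IsEven _≟_ σ → A → A
  preimage (ps , _) = applyPairs _≟_ (reversePairs ps)

  preimage-section : ∀ {σ} (ev : IsEven _≟_ σ) w → σ (preimage ev w) ≡ w
  preimage-section (ps , σ≈ps) w = trans (σ≈ps _) (reversePairs-inverseʳ ps w)

  even-injective : ∀ {σ} → IsEven _≟_ σ → ∀ {u w} → σ u ≡ σ w → u ≡ w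
  even-injective (ps , σ≈ps) {u} {w} σu≡σw = begin
    u                                                        ≡⟨ sym (reversePairs-inverseˡ ps u) ⟩
    applyPairs _≟_ (reversePairs ps) (applyPairs _≟_ ps u)  ≡⟨ cong (applyPairs _≟_ (reversePairs ps)) (trans (sym (σ≈ps u)) (trans σu≡σw (σ≈ps w))) ⟩
    applyPairs _≟_ (reversePairs ps) (applyPairs _≟_ ps w)  ≡⟨ reversePairs-inverseˡ ps w ⟩
    w                                                        ∎
    where open ≡-Reasoning

  -- Greedy factorisation into transpositions along an enumeration. Its output is only used
  -- through an exhaustive check, so its correctness is never proved.
  decompose : (A → A) → List A → List (Transposition _≟_)
  decompose σ []       = []
  decompose σ (u ∷ us) with u ≟ σ u
  ... | yes _    = decompose σ us
  ... | no u≢σu  = decompose (swap _≟_ u (σ u) ∘ σ) us ++ ((u , σ u , u≢σu) ∷ [])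

  pairUp : List (Transposition _≟_) → Pairs
  pairUp (s ∷ t ∷ ts) = (s , t) ∷ pairUp ts
  pairUp _            = []

  evens-by-decomposition : {I : Set} (∀I? : Decidable∀ I) (∀A? : Decidable∀ A) (us : List A) (σ : I → A → A) →
    True (∀I? λ k → ∀A? λ u → σ k u ≟ applyPairs _≟_ (pairUp (decompose (σ k) us)) u) →
    ∀ k → IsEven _≟_ (σ k)
  evens-by-decomposition ∀I? ∀A? us σ check k = pairUp (decompose (σ k) us) , toWitness check k

module Transport {A B : Set} (_≟A_ : DecidableEquality A) (_≟B_ : DecidableEquality B)
                 (f : A → B) (f-injective : Injective _≡_ _≡_ f) where

  mapT : Transposition _≟A_ → Transposition _≟B_
  mapT (u , v , u≢v) = f u , f v , u≢v ∘ f-injective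

  does-map : ∀ x u → does (f x ≟B f u) ≡ does (x ≟A u)
  does-map x u with x ≟A u
  ... | yes refl = dec-true (f x ≟B f x) refl
  ... | no x≢u   = dec-false (f x ≟B f u) (x≢u ∘ f-injective)

  applyT-map : ∀ t x → applyT _≟B_ (mapT t) (f x) ≡ f (applyT _≟A_ t x)
  applyT-map (u , v , _) x rewrite does-map x u | does-map x v with does (x ≟A u) | does (x ≟A v)
  ... | true  | _     = refl
  ... | false | true  = refl
  ... | false | false = refl

  mapPairs : List (Transposition _≟A_ × Transposition _≟A_) → List (Transposition _≟B_ × Transposition _≟B_)
  mapPairs []             = []
  mapPairs ((s , t) ∷ ps) = (mapT s , mapT t) ∷ mapPairs ps

  applyPairs-map : ∀ ps x → applyPairs _≟B_ (mapPairs ps) (f x) ≡ f (applyPairs _≟A_ ps x)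
  applyPairs-map []             x = refl
  applyPairs-map ((s , t) ∷ ps) x = begin
    applyPairs _≟B_ (mapPairs ps) (applyT _≟B_ (mapT t) (applyT _≟B_ (mapT s) (f x)))
      ≡⟨ cong (applyPairs _≟B_ (mapPairs ps) ∘ applyT _≟B_ (mapT t)) (applyT-map s x) ⟩
    applyPairs _≟B_ (mapPairs ps) (applyT _≟B_ (mapT t) (f (applyT _≟A_ s x)))
      ≡⟨ cong (applyPairs _≟B_ (mapPairs ps)) (applyT-map t _) ⟩
    applyPairs _≟B_ (mapPairs ps) (f (applyT _≟A_ t (applyT _≟A_ s x)))
      ≡⟨ applyPairs-map ps _ ⟩
    f (applyPairs _≟A_ ps (applyT _≟A_ t (applyT _≟A_ s x))) ∎
    where open ≡-Reasoning

module Doubling {A B : Set} (_≟A_ : DecidableEquality A) (_≟B_ : DecidableEquality B)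
                (copy : Bool → A → B) (copy-injective : ∀ b → Injective _≡_ _≡_ (copy b))
                (copies-disjoint : ∀ x y → copy false x ≢ copy true y) where

  open Transpositions _≟B_ using (swap-fixes)
  module Copy (b : Bool) = Transport _≟A_ _≟B_ (copy b) (copy-injective b)
  open Copy using (mapT; applyT-map)

  copies-disjoint-not : ∀ b x y → copy b x ≢ copy (not b) y
  copies-disjoint-not false x y = copies-disjoint x y
  copies-disjoint-not true  x y = copies-disjoint y x ∘ sym

  mapT-other : ∀ b t x → applyT _≟B_ (mapT (not b) t) (copy b x) ≡ copy b x
  mapT-other b (u , v , _) x = swap-fixes _ _ _ (copies-disjoint-not b x u) (copies-disjoint-not b x v)

  applyT-double : ∀ t b x → applyT _≟B_ (mapT true t) (applyT _≟B_ (mapT false t) (copy b x)) ≡ copy b (applyT _≟A_ t x)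
  applyT-double t false x = trans (cong (applyT _≟B_ (mapT true t)) (applyT-map false t x)) (mapT-other false t _)
  applyT-double t true  x = trans (cong (applyT _≟B_ (mapT true t)) (mapT-other true t x)) (applyT-map true t x)

  double : List (Transposition _≟A_ × Transposition _≟A_) → List (Transposition _≟B_ × Transposition _≟B_)
  double []             = []
  double ((s , t) ∷ ps) = (mapT false s , mapT true s) ∷ (mapT false t , mapT true t) ∷ double ps

  applyPairs-double : ∀ ps b x → applyPairs _≟B_ (double ps) (copy b x) ≡ copy b (applyPairs _≟A_ ps x)
  applyPairs-double []             b x = refl
  applyPairs-double ((s , t) ∷ ps) b x =
    trans (cong (applyPairs _≟B_ (double ps) ∘ applyT _≟B_ (mapT true t) ∘ applyT _≟B_ (mapT false t)) (applyT-double s b x))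
   (trans (cong (applyPairs _≟B_ (double ps)) (applyT-double t b _))
          (applyPairs-double ps b _))

  doubled-even : ∀ {σ : A → A} {σ̂ : B → B} → IsEven _≟A_ σ →
    (∀ b x → σ̂ (copy b x) ≡ copy b (σ x)) → (∀ y → ∃₂ λ b x → copy b x ≡ y) → IsEven _≟B_ σ̂
  doubled-even {σ} {σ̂} (ps , σ≈ps) σ̂-copy copies-cover = double ps , λ y → σ̂-at y (copies-cover y)
    where
      σ̂-at : ∀ y → ∃₂ (λ b x → copy b x ≡ y) → σ̂ y ≡ applyPairs _≟B_ (double ps) y
      σ̂-at _ (b , x , refl) = trans (σ̂-copy b x) (trans (cong (copy b) (σ≈ps x)) (sym (applyPairs-double ps b x)))

-- Right translations of D₈ × C₂ⁿ are even

Hn : ℕ → Set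
Hn n = Z4 × Bool × Vec Bool n

_≟Hn_ : ∀ {n} → DecidableEquality (Hn n)
_≟Hn_ = Product.≡-dec F._≟_ (Product.≡-dec Bool._≟_ (Vec.≡-dec Bool._≟_))

∀-Hn? : ∀ n → Decidable∀ (Hn n)
∀-Hn? n = ∀-×? all? (∀-×? ∀-Bool? (∀-Vec? ∀-Bool? n))

elements₀ : List (Hn 0)
elements₀ = cartesianProductWith (λ i j → i , j , []) (allFin 4) (false ∷ true ∷ [])

elements₁ : List (Hn 1)
elements₁ = cartesianProductWith (λ (i , j , _) b → i , j , b ∷ []) elements₀ (false ∷ true ∷ [])

-- The multiplication _·_ m of Defs with the number m ∸ 3 of C₂ factors made a variable,
-- so that evenness of translations can be proved by induction on it.
_·ₙ_ : ∀ {n} → Hn n → Hn n → Hn n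
(i , j , v) ·ₙ (k , l , w) = (i +₄ (if j then -₄ k else k)) , (j xor l) , zipWith _xor_ v w

flipFirst : ∀ {n} → Hn (suc n) → Hn (suc n)
flipFirst (i , j , b ∷ v) = i , j , not b ∷ v

translations₀-even : ∀ (k : Hn 0) → IsEven _≟Hn_ (_·ₙ k)
translations₀-even = evens-by-decomposition (∀-Hn? 0) (∀-Hn? 0) elements₀ (λ k u → u ·ₙ k) _
  where open Transpositions _≟Hn_

flipFirst₁-even : IsEven _≟Hn_ (flipFirst {0})
flipFirst₁-even = evens-by-decomposition ∀-⊤? (∀-Hn? 1) elements₁ (λ _ → flipFirst) _ tt
  where open Transpositions _≟Hn_

insertFirst : ∀ {n} → Bool → Hn n → Hn (suc n)
insertFirst b (i , j , v) = i , j , b ∷ v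

insertSecond : ∀ {n} → Bool → Hn (suc n) → Hn (suc (suc n))
insertSecond c (i , j , b ∷ v) = i , j , b ∷ c ∷ v

insertFirst-injective : ∀ {n} b → Injective _≡_ _≡_ (insertFirst {n} b)
insertFirst-injective b {_ , _ , _} {_ , _ , _} refl = refl

insertSecond-injective : ∀ {n} c → Injective _≡_ _≡_ (insertSecond {n} c)
insertSecond-injective c {_ , _ , _ ∷ _} {_ , _ , _ ∷ _} refl = refl

insertFirst-disjoint : ∀ {n} (u w : Hn n) → insertFirst false u ≢ insertFirst true w
insertFirst-disjoint _ _ ()

insertSecond-disjoint : ∀ {n} (u w : Hn (suc n)) → insertSecond false u ≢ insertSecond true w
insertSecond-disjoint (_ , _ , _ ∷ _) (_ , _ , _ ∷ _) ()

insertFirst-covers : ∀ {n} (u : Hn (suc n)) → ∃₂ λ b w → insertFirst b w ≡ u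
insertFirst-covers (i , j , b ∷ v) = b , (i , j , v) , refl

insertSecond-covers : ∀ {n} (u : Hn (suc (suc n))) → ∃₂ λ c w → insertSecond c w ≡ u
insertSecond-covers (i , j , b ∷ c ∷ v) = c , (i , j , b ∷ v) , refl

module FirstBit (n : ℕ) = Doubling (_≟Hn_ {n}) _≟Hn_ insertFirst insertFirst-injective insertFirst-disjoint
module SecondBit (n : ℕ) = Doubling (_≟Hn_ {suc n}) _≟Hn_ insertSecond insertSecond-injective insertSecond-disjoint

flipFirst-insertSecond : ∀ {n} c (u : Hn (suc n)) → flipFirst (insertSecond c u) ≡ insertSecond c (flipFirst u)
flipFirst-insertSecond c (_ , _ , _ ∷ _) = refl

flipFirst-even : ∀ n → IsEven _≟Hn_ (flipFirst {n})
flipFirst-even zero    = flipFirst₁-even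
flipFirst-even (suc n) = SecondBit.doubled-even n (flipFirst-even n) flipFirst-insertSecond insertSecond-covers

·ₙ-insertFirst : ∀ {n} (k : Hn n) b u → insertFirst b u ·ₙ insertFirst false k ≡ insertFirst b (u ·ₙ k)
·ₙ-insertFirst k b (_ , _ , _) = cong (λ b′ → _ , _ , b′ ∷ _) (xor-identityʳ b)

·ₙ-true : ∀ {n} (k : Hn n) (u : Hn (suc n)) → flipFirst (u ·ₙ insertFirst false k) ≡ u ·ₙ insertFirst true k
·ₙ-true k (_ , _ , b ∷ _) = cong (λ b′ → _ , _ , b′ ∷ _) (not-distribʳ-xor b false)

translation-insertFirst-even : ∀ n (k : Hn n) → IsEven _≟Hn_ (_·ₙ k) → IsEven _≟Hn_ (_·ₙ insertFirst false k)
translation-insertFirst-even n k k-even = FirstBit.doubled-even n k-even (·ₙ-insertFirst k) insertFirst-covers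

translations-even : ∀ n (k : Hn n) → IsEven _≟Hn_ (_·ₙ k)
translations-even zero    = translations₀-even
translations-even (suc n) (i , j , false ∷ v) = translation-insertFirst-even n (i , j , v) (translations-even n (i , j , v))
translations-even (suc n) (i , j , true ∷ v)  = Transpositions.even-resp _≟Hn_ (·ₙ-true (i , j , v))
  (even-· _≟Hn_ (translation-insertFirst-even n (i , j , v) (translations-even n (i , j , v))) (flipFirst-even n))

D8 : Set
D8 = Z4 × Bool

_∘D_ : D8 → D8 → D8
(i , j) ∘D (k , l) = (i +₄ (if j then -₄ k else k)) , (j xor l)

invD : D8 → D8
invD (i , false) = -₄ i , false
invD (i , true)  = i , true

εD : D8
εD = F.zero , false

aD bD : D8
aD = F.suc F.zero , false
bD = F.zero , true

a²D : D8
a²D = F.suc (F.suc F.zero) , false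

abD : D8
abD = aD ∘D bD

_≟D8_ : DecidableEquality D8
_≟D8_ = Product.≡-dec F._≟_ Bool._≟_

∀-D8? : Decidable∀ D8
∀-D8? = ∀-×? all? ∀-Bool?

∘D-assoc : ∀ p q r → (p ∘D q) ∘D r ≡ p ∘D (q ∘D r)
∘D-assoc = toWitness {a? = ∀-D8? λ p → ∀-D8? λ q → ∀-D8? λ r → ((p ∘D q) ∘D r) ≟D8 (p ∘D (q ∘D r))} _

∘D-identity : ∀ p → εD ∘D p ≡ p × p ∘D εD ≡ p
∘D-identity = toWitness {a? = ∀-D8? λ p → ((εD ∘D p) ≟D8 p) ×-dec ((p ∘D εD) ≟D8 p)} _

∘D-inverse : ∀ p → invD p ∘D p ≡ εD × p ∘D invD p ≡ εD
∘D-inverse = toWitness {a? = ∀-D8? λ p → ((invD p ∘D p) ≟D8 εD) ×-dec ((p ∘D invD p) ≟D8 εD)} _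

powD : D8 → ℕ → D8
powD p zero    = εD
powD p (suc k) = p ∘D powD p k

εD-a²D-central : ∀ p → p ∘D εD ≡ εD ∘D p × p ∘D a²D ≡ a²D ∘D p
εD-a²D-central = toWitness {a? = ∀-D8? λ p → ((p ∘D εD) ≟D8 (εD ∘D p)) ×-dec ((p ∘D a²D) ≟D8 (a²D ∘D p))} _

δx : D8 → D8
δx (i , j) = powD (powD aD 3) (toℕ i) ∘D powD (aD ∘D bD) (if j then 1 else 0)

δx-∘ : ∀ p q → δx (p ∘D q) ≡ δx p ∘D δx q
δx-∘ = toWitness {a? = ∀-D8? λ p → ∀-D8? λ q → δx (p ∘D q) ≟D8 (δx p ∘D δx q)} _

δx-involutive : ∀ p → δx (δx p) ≡ p
δx-involutive = toWitness {a? = ∀-D8? λ p → δx (δx p) ≟D8 p} _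

evenD : D8 → Bool
evenD (i , _) = isEvenℕ (toℕ i)

InK : D8 → Set
InK p = evenD p ≡ true

δτ : D8 → D8
δτ (i , j) = powD bD ⌊ toℕ i /2⌋ ∘D powD a²D (if j then 1 else 0)

δτ-InK : ∀ p → InK (δτ p)
δτ-InK = toWitness {a? = ∀-D8? λ p → evenD (δτ p) Bool.≟ true} _

δτ-∘ : ∀ p q → InK p → InK q → δτ (p ∘D q) ≡ δτ p ∘D δτ q
δτ-∘ = toWitness {a? = ∀-D8? λ p → ∀-D8? λ q →
         (evenD p Bool.≟ true) →-dec ((evenD q Bool.≟ true) →-dec (δτ (p ∘D q) ≟D8 (δτ p ∘D δτ q)))} _

δτ-involutive : ∀ p → InK p → δτ (δτ p) ≡ p
δτ-involutive = toWitness {a? = ∀-D8? λ p → (evenD p Bool.≟ true) →-dec (δτ (δτ p) ≟D8 p)} _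

evenD-∘ : ∀ p q → InK q → evenD (p ∘D q) ≡ evenD p
evenD-∘ = toWitness {a? = ∀-D8? λ p → ∀-D8? λ q → (evenD q Bool.≟ true) →-dec (evenD (p ∘D q) Bool.≟ evenD p)} _

a⁻¹-∘-odd : ∀ q → evenD q ≡ false → InK (invD aD ∘D q)
a⁻¹-∘-odd = toWitness {a? = ∀-D8? λ q → (evenD q Bool.≟ false) →-dec (evenD (invD aD ∘D q) Bool.≟ true)} _

isEvenℕ-+2 : ∀ k → isEvenℕ (suc (suc k)) ≡ isEvenℕ k
isEvenℕ-+2 k = not-involutive (isEvenℕ k)

odd⇒≥1 : ∀ {k} → isEvenℕ k ≡ false → 1 ≤ k
odd⇒≥1 {suc k} _ = s≤s z≤n

shiftedBit : ℕ → ℕ → ∀ {l} → Vec Bool l → Bool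
shiftedBit p       zero    []      = false
shiftedBit zero    zero    (b ∷ v) = b
shiftedBit (suc p) zero    (b ∷ v) = shiftedBit p zero v
shiftedBit zero    (suc s) v       = false
shiftedBit (suc p) (suc s) v       = shiftedBit p s v

shiftedBit-[] : ∀ p s → shiftedBit p s [] ≡ false
shiftedBit-[] p       zero    = refl
shiftedBit-[] zero    (suc s) = refl
shiftedBit-[] (suc p) (suc s) = shiftedBit-[] p s

shiftedBit-∷ : ∀ p s b {l} (v : Vec Bool l) → shiftedBit p s (b ∷ v) ≡ ((p ≡ᵇ s) ∧ b) xor shiftedBit p (suc s) v
shiftedBit-∷ zero    zero    b v = sym (xor-identityʳ b)
shiftedBit-∷ (suc p) zero    b v = refl
shiftedBit-∷ zero    (suc s) b v = refl
shiftedBit-∷ (suc p) (suc s) b v = shiftedBit-∷ p s b v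

tabulate-shiftedBit-zero : ∀ {l} (v : Vec Bool l) → tabulate (λ i → shiftedBit (toℕ i) 0 v) ≡ v
tabulate-shiftedBit-zero []      = refl
tabulate-shiftedBit-zero (b ∷ v) = cong (b ∷_) (tabulate-shiftedBit-zero v)

range-tail : ∀ {P : ℕ → Set} {s l} → (∀ k → s ≤ k → k < s + suc l → P k) → ∀ k → suc s ≤ k → k < suc s + l → P k
range-tail {s = s} {l} P-range k s<k k<1+s+l = P-range k (ℕ.<⇒≤ s<k) (subst (k <_) (sym (ℕ.+-suc s l)) k<1+s+l)

⊕-self : ∀ {l} (v : Vec Bool l) → zipWith _xor_ v v ≡ replicate l false
⊕-self v = trans (cong (λ w → zipWith _xor_ w v) (sym (Vec.map-id v))) (Vec.zipWith-inverseˡ xor-same v)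

tabulate-false : ∀ {l} → tabulate {n = l} (λ _ → false) ≡ replicate l false
tabulate-false {zero}  = refl
tabulate-false {suc l} = cong (false ∷_) tabulate-false

zipWith-tabulate : ∀ {l} (f : Bool → Bool → Bool) (g g′ : Fin l → Bool) →
                   zipWith f (tabulate g) (tabulate g′) ≡ tabulate (λ i → f (g i) (g′ i))
zipWith-tabulate {zero}  f g g′ = refl
zipWith-tabulate {suc l} f g g′ = cong (f (g F.zero) (g′ F.zero) ∷_) (zipWith-tabulate f (g ∘ F.suc) (g′ ∘ F.suc))

module GroupH (m : ℕ) where

  infix 8 _⋈_
  _⋈_ : D8 → Vec Bool (m ∸ 3) → H m
  (i , j) ⋈ v = i , j , v

  H-isGroup : IsGroup _≡_ (_·_ m) (e m) (inv m)
  H-isGroup = record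
    { isMonoid = record
      { isSemigroup = record
        { isMagma = record { isEquivalence = isEquivalence ; ∙-cong = cong₂ (_·_ m) }
        ; assoc   = λ { (i , j , u) (k , l , v) (p , q , w) →
                        cong₂ _⋈_ (∘D-assoc (i , j) (k , l) (p , q)) (Vec.zipWith-assoc xor-assoc u v w) } }
      ; identity = (λ { (i , j , v) → cong₂ _⋈_ (proj₁ (∘D-identity (i , j))) (Vec.zipWith-identityˡ xor-identityˡ v) })
                 , (λ { (i , j , v) → cong₂ _⋈_ (proj₂ (∘D-identity (i , j))) (Vec.zipWith-identityʳ xor-identityʳ v) }) }
    ; inverse = (λ { (i , false , v) → cong₂ _⋈_ (proj₁ (∘D-inverse (i , false))) (⊕-self v)
                   ; (i , true  , v) → cong₂ _⋈_ (proj₁ (∘D-inverse (i , true))) (⊕-self v) })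
              , (λ { (i , false , v) → cong₂ _⋈_ (proj₂ (∘D-inverse (i , false))) (⊕-self v)
                   ; (i , true  , v) → cong₂ _⋈_ (proj₂ (∘D-inverse (i , true))) (⊕-self v) })
    ; ⁻¹-cong = cong (inv m)
    }

  H-group : Group 0ℓ 0ℓ
  H-group = record { isGroup = H-isGroup }

  open Group H-group public using (_∙_; ε; _⁻¹; assoc; identityˡ; identityʳ; inverseˡ)
  open GroupProperties H-group public using (inverseʳ-unique; //-rightDividesʳ; //-rightDividesˡ; \\-leftDividesʳ; \\-leftDividesˡ)

  data Central : H m → Set where
    central-ε  : ∀ v → Central (εD ⋈ v)
    central-a² : ∀ v → Central (a²D ⋈ v)

  central-comm : ∀ {u} → Central u → ∀ w → w ∙ u ≡ u ∙ w
  central-comm (central-ε v)  (i , j , w) = cong₂ _⋈_ (proj₁ (εD-a²D-central (i , j))) (Vec.zipWith-comm xor-comm w v)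
  central-comm (central-a² v) (i , j , w) = cong₂ _⋈_ (proj₂ (εD-a²D-central (i , j))) (Vec.zipWith-comm xor-comm w v)

  ∙-central : ∀ {u w} → Central u → Central w → Central (u ∙ w)
  ∙-central (central-ε _)  (central-ε _)  = central-ε _
  ∙-central (central-ε _)  (central-a² _) = central-a² _
  ∙-central (central-a² _) (central-ε _)  = central-a² _
  ∙-central (central-a² _) (central-a² _) = central-ε _

  central-square : ∀ {u} → Central u → u ∙ u ≡ ε
  central-square (central-ε v)  = cong (εD ⋈_) (⊕-self v)
  central-square (central-a² v) = cong (εD ⋈_) (⊕-self v)

  central-cancel : ∀ {A} → Central A → ∀ u → A ∙ (A ∙ u) ≡ u
  central-cancel {A} A-central u = begin
    A ∙ (A ∙ u)  ≡⟨ sym (assoc A A u) ⟩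
    (A ∙ A) ∙ u  ≡⟨ cong (_∙ u) (central-square A-central) ⟩
    ε ∙ u        ≡⟨ identityˡ u ⟩
    u            ∎
    where open ≡-Reasoning

  central-cancelʳ : ∀ {A} → Central A → ∀ u → (u ∙ A) ∙ A ≡ u
  central-cancelʳ {A} A-central u = begin
    (u ∙ A) ∙ A  ≡⟨ assoc u A A ⟩
    u ∙ (A ∙ A)  ≡⟨ cong (u ∙_) (central-square A-central) ⟩
    u ∙ ε        ≡⟨ identityʳ u ⟩
    u            ∎
    where open ≡-Reasoning

  central-pair-cancel : ∀ {A B} → Central A → Central B → ∀ u → A ∙ (B ∙ (A ∙ (B ∙ u))) ≡ u
  central-pair-cancel {A} {B} A-central B-central u = begin
    A ∙ (B ∙ (A ∙ (B ∙ u)))  ≡⟨ cong (A ∙_) (sym (assoc B A (B ∙ u))) ⟩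
    A ∙ ((B ∙ A) ∙ (B ∙ u))  ≡⟨ cong (λ t → A ∙ (t ∙ (B ∙ u))) (central-comm A-central B) ⟩
    A ∙ ((A ∙ B) ∙ (B ∙ u))  ≡⟨ cong (A ∙_) (assoc A B (B ∙ u)) ⟩
    A ∙ (A ∙ (B ∙ (B ∙ u)))  ≡⟨ central-cancel A-central _ ⟩
    B ∙ (B ∙ u)              ≡⟨ central-cancel B-central u ⟩
    u                        ∎
    where open ≡-Reasoning

  central-swapʳ : ∀ A B {C} → Central C → (A ∙ B) ∙ C ≡ (A ∙ C) ∙ B
  central-swapʳ A B {C} C-central = begin
    (A ∙ B) ∙ C  ≡⟨ assoc A B C ⟩
    A ∙ (B ∙ C)  ≡⟨ cong (A ∙_) (central-comm C-central B) ⟩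
    A ∙ (C ∙ B)  ≡⟨ sym (assoc A C B) ⟩
    (A ∙ C) ∙ B  ∎
    where open ≡-Reasoning

  interchange : ∀ A P B Q → Central P → (A ∙ P) ∙ (B ∙ Q) ≡ (A ∙ B) ∙ (P ∙ Q)
  interchange A P B Q P-central = begin
    (A ∙ P) ∙ (B ∙ Q)  ≡⟨ assoc A P (B ∙ Q) ⟩
    A ∙ (P ∙ (B ∙ Q))  ≡⟨ cong (A ∙_) (sym (assoc P B Q)) ⟩
    A ∙ ((P ∙ B) ∙ Q)  ≡⟨ cong (λ t → A ∙ (t ∙ Q)) (sym (central-comm P-central B)) ⟩
    A ∙ ((B ∙ P) ∙ Q)  ≡⟨ cong (A ∙_) (assoc B P Q) ⟩
    A ∙ (B ∙ (P ∙ Q))  ≡⟨ sym (assoc A B (P ∙ Q)) ⟩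
    (A ∙ B) ∙ (P ∙ Q)  ∎
    where open ≡-Reasoning

  if-central : ∀ t {u w} → Central u → Central w → Central (if t then u else w)
  if-central true  u-central _ = u-central
  if-central false _ w-central = w-central

  c-central : ∀ k → Central (c m k)
  c-central k = central-ε _

  a²-central : Central (a² m)
  a²-central = central-a² _

  ι : D8 → H m
  ι p = p ⋈ replicate _ false

  ι-∙ : ∀ p q → ι p ∙ ι q ≡ ι (p ∘D q)
  ι-∙ p q = cong ((p ∘D q) ⋈_) (⊕-self _)

  ι-injective : ∀ {p q} → ι p ≡ ι q → p ≡ q
  ι-injective {_ , _} {_ , _} refl = refl

  ι-∙-⋈ : ∀ p v → ι p ∙ (εD ⋈ v) ≡ p ⋈ v
  ι-∙-⋈ p v = cong₂ _⋈_ (proj₂ (∘D-identity p)) (Vec.zipWith-identityˡ xor-identityˡ v)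

  a²≡ι : a² m ≡ ι a²D
  a²≡ι = ι-∙ aD aD

  pow-ι : ∀ p k → pow m (ι p) k ≡ ι (powD p k)
  pow-ι p zero    = refl
  pow-ι p (suc k) = trans (cong (ι p ∙_) (pow-ι p k)) (ι-∙ p (powD p k))

  pow-ι-∙-pow-ι : ∀ p q i j P → pow m (ι p) i ∙ (pow m (ι q) j ∙ P) ≡ ι (powD p i ∘D powD q j) ∙ P
  pow-ι-∙-pow-ι p q i j P = begin
    pow m (ι p) i ∙ (pow m (ι q) j ∙ P)  ≡⟨ cong₂ (λ A B → A ∙ (B ∙ P)) (pow-ι p i) (pow-ι q j) ⟩
    ι (powD p i) ∙ (ι (powD q j) ∙ P)    ≡⟨ assoc (ι (powD p i)) (ι (powD q j)) P ⟨
    (ι (powD p i) ∙ ι (powD q j)) ∙ P    ≡⟨ cong (_∙ P) (ι-∙ (powD p i) (powD q j)) ⟩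
    ι (powD p i ∘D powD q j) ∙ P         ∎
    where open ≡-Reasoning

  d8 : H m → D8
  d8 (i , j , _) = i , j

  d8-inv : ∀ u → d8 (u ⁻¹) ≡ invD (d8 u)
  d8-inv (_ , false , _) = refl
  d8-inv (_ , true  , _) = refl

  d8-prodUpTo : ∀ (f : ℕ → H m) → (∀ i → d8 (f i) ≡ εD) → ∀ K → d8 (prodUpTo m f K) ≡ εD
  d8-prodUpTo f f-εD zero    = f-εD 0
  d8-prodUpTo f f-εD (suc K) = cong₂ _∘D_ (d8-prodUpTo f f-εD K) (f-εD (suc K))

  module _ {C : ℕ → H m} (C-central : ∀ k → Central (C k)) where

    prodFrom-central : ∀ s {l} (v : Vec Bool l) → Central (prodFrom m C s v)
    prodFrom-central s []           = central-ε _
    prodFrom-central s (true  ∷ v) = ∙-central (C-central s) (prodFrom-central (suc s) v)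
    prodFrom-central s (false ∷ v) = prodFrom-central (suc s) v

    prodFrom-⊕ : ∀ s {l} (v w : Vec Bool l) →
                 prodFrom m C s (zipWith _xor_ v w) ≡ prodFrom m C s v ∙ prodFrom m C s w
    prodFrom-⊕ s []          []          = sym (identityˡ ε)
    prodFrom-⊕ s (false ∷ v) (false ∷ w) = prodFrom-⊕ (suc s) v w
    prodFrom-⊕ s (false ∷ v) (true ∷ w)  = begin
      C s ∙ prodFrom m C (suc s) (zipWith _xor_ v w) ≡⟨ cong (C s ∙_) (prodFrom-⊕ (suc s) v w) ⟩
      C s ∙ (P ∙ Q)                                   ≡⟨ sym (assoc (C s) P Q) ⟩
      (C s ∙ P) ∙ Q                                   ≡⟨ cong (_∙ Q) (sym (central-comm (C-central s) P)) ⟩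
      (P ∙ C s) ∙ Q                                   ≡⟨ assoc P (C s) Q ⟩
      P ∙ (C s ∙ Q)                                   ∎
      where open ≡-Reasoning
            P Q : H m
            P = prodFrom m C (suc s) v
            Q = prodFrom m C (suc s) w
    prodFrom-⊕ s (true ∷ v) (false ∷ w) =
      trans (cong (C s ∙_) (prodFrom-⊕ (suc s) v w)) (sym (assoc (C s) _ _))
    prodFrom-⊕ s (true ∷ v) (true ∷ w)  = begin
      prodFrom m C (suc s) (zipWith _xor_ v w) ≡⟨ prodFrom-⊕ (suc s) v w ⟩
      P ∙ Q                                     ≡⟨ sym (identityˡ (P ∙ Q)) ⟩
      ε ∙ (P ∙ Q)                               ≡⟨ cong (_∙ (P ∙ Q)) (sym (central-square (C-central s))) ⟩
      (C s ∙ C s) ∙ (P ∙ Q)                     ≡⟨ sym (interchange (C s) P (C s) Q (prodFrom-central (suc s) v)) ⟩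
      (C s ∙ P) ∙ (C s ∙ Q)                     ∎
      where open ≡-Reasoning
            P Q : H m
            P = prodFrom m C (suc s) v
            Q = prodFrom m C (suc s) w

    prodFrom-map : (f : H m → H m) → (∀ {u w} → Central u → Central w → f (u ∙ w) ≡ f u ∙ f w) → f ε ≡ ε →
                   ∀ s {l} (v : Vec Bool l) → f (prodFrom m C s v) ≡ prodFrom m (f ∘ C) s v
    prodFrom-map f f-∙ f-ε s []           = f-ε
    prodFrom-map f f-∙ f-ε s (false ∷ v) = prodFrom-map f f-∙ f-ε (suc s) v
    prodFrom-map f f-∙ f-ε s (true  ∷ v) =
      trans (f-∙ (C-central s) (prodFrom-central (suc s) v)) (cong (f (C s) ∙_) (prodFrom-map f f-∙ f-ε (suc s) v))

  prodFrom-cong : ∀ {C C′ : ℕ → H m} s {l} (v : Vec Bool l) → (∀ k → s ≤ k → k < s + l → C k ≡ C′ k) →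
                  prodFrom m C s v ≡ prodFrom m C′ s v
  prodFrom-cong s []          C≗C′ = refl
  prodFrom-cong s (false ∷ v) C≗C′ = prodFrom-cong (suc s) v (range-tail C≗C′)
  prodFrom-cong s (true ∷ v)  C≗C′ = cong₂ _∙_ (C≗C′ s ℕ.≤-refl (ℕ.m<m+n s (s≤s z≤n))) (prodFrom-cong (suc s) v (range-tail C≗C′))

  prodFrom-replicate : ∀ (C : ℕ → H m) s l → prodFrom m C s (replicate l false) ≡ ε
  prodFrom-replicate C s zero    = refl
  prodFrom-replicate C s (suc l) = prodFrom-replicate C (suc s) l

  unitVec : ∀ {l} → ℕ → Vec Bool l
  unitVec d = tabulate (λ i → toℕ i ≡ᵇ d)

  prodFrom-unitVec : ∀ (C : ℕ → H m) s {l} d → d < l → prodFrom m C s (unitVec {l} d) ≡ C (d + s)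
  prodFrom-unitVec C s {suc l} zero    _         = begin
    C s ∙ prodFrom m C (suc s) (tabulate {n = l} (λ _ → false)) ≡⟨ cong (λ v → C s ∙ prodFrom m C (suc s) v) (tabulate-false {l}) ⟩
    C s ∙ prodFrom m C (suc s) (replicate l false)             ≡⟨ cong (C s ∙_) (prodFrom-replicate C (suc s) l) ⟩
    C s ∙ ε                                                    ≡⟨ identityʳ (C s) ⟩
    C s                                                        ∎
    where open ≡-Reasoning
  prodFrom-unitVec C s {suc l} (suc d) (s≤s d<l) = trans (prodFrom-unitVec C (suc s) d d<l) (cong C (ℕ.+-suc d s))

  prodFrom-c-shifted : ∀ s {l} (v : Vec Bool l) → prodFrom m (c m) (suc s) v ≡ εD ⋈ tabulate (λ i → shiftedBit (toℕ i) s v)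
  prodFrom-c-shifted s []          =
    cong (εD ⋈_) (sym (trans (Vec.tabulate-cong (λ i → shiftedBit-[] (toℕ i) s)) tabulate-false))
  prodFrom-c-shifted s (false ∷ v) = trans (prodFrom-c-shifted (suc s) v) (cong (εD ⋈_) (Vec.tabulate-cong λ i →
    sym (trans (shiftedBit-∷ (toℕ i) s false v) (cong (_xor shiftedBit (toℕ i) (suc s) v) (∧-zeroʳ (toℕ i ≡ᵇ s))))))
  prodFrom-c-shifted s (true ∷ v)  = trans (cong (c m (suc s) ∙_) (prodFrom-c-shifted (suc s) v)) (cong (εD ⋈_) (
    trans (zipWith-tabulate _xor_ _ _) (Vec.tabulate-cong λ i →
    sym (trans (shiftedBit-∷ (toℕ i) s true v) (cong (_xor shiftedBit (toℕ i) (suc s) v) (∧-identityʳ (toℕ i ≡ᵇ s)))))))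

  prodFrom-c : ∀ v → prodFrom m (c m) 1 v ≡ εD ⋈ v
  prodFrom-c v = trans (prodFrom-c-shifted 0 v) (cong (εD ⋈_) (tabulate-shiftedBit-zero v))

  c0≡ε : c m 0 ≡ ε
  c0≡ε = cong (εD ⋈_) tabulate-false

  c-five-term : ∀ A B C D E → (c m A ∙ (c m B ∙ c m D)) ∙ ((c m A ∙ (c m B ∙ c m C)) ∙ (c m C ∙ (c m D ∙ c m E))) ≡ c m E
  c-five-term A B C D E = cong (εD ⋈_) (xor-five (unit A) (unit B) (unit C) (unit D) (unit E))
    where
      unit : ℕ → Vec Bool (m ∸ 3)
      unit k = tabulate (λ i → suc (toℕ i) ≡ᵇ k)
      _⊕_ : ∀ {l} → Vec Bool l → Vec Bool l → Vec Bool l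
      _⊕_ = zipWith _xor_
      xor-five-bits : ∀ a b c d e → (a xor (b xor d)) xor ((a xor (b xor c)) xor (c xor (d xor e))) ≡ e
      xor-five-bits = toWitness {a? = ∀-Bool? λ a → ∀-Bool? λ b → ∀-Bool? λ c → ∀-Bool? λ d → ∀-Bool? λ e →
                        ((a xor (b xor d)) xor ((a xor (b xor c)) xor (c xor (d xor e)))) Bool.≟ e} _
      xor-five : ∀ {l} (a b c d e : Vec Bool l) → (a ⊕ (b ⊕ d)) ⊕ ((a ⊕ (b ⊕ c)) ⊕ (c ⊕ (d ⊕ e))) ≡ e
      xor-five [] [] [] [] [] = refl
      xor-five (a ∷ as) (b ∷ bs) (c ∷ cs) (d ∷ ds) (e ∷ es) = cong₂ _∷_ (xor-five-bits a b c d e) (xor-five as bs cs ds es)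

  module Twist (Dom : D8 → Set) (Dom-εD : Dom εD) (Dom-a²D : Dom a²D)
               (δ : D8 → D8) (δ-εD : δ εD ≡ εD) (δ-Dom : ∀ p → Dom (δ p))
               (δ-∘ : ∀ p q → Dom p → Dom q → δ (p ∘D q) ≡ δ p ∘D δ q)
               (δ-involutive : ∀ p → Dom p → δ (δ p) ≡ p)
               (C : ℕ → H m) (C-central : ∀ k → Central (C k)) where

    twist : H m → H m
    twist (i , j , v) = ι (δ (i , j)) ∙ prodFrom m C 1 v

    central-Dom : ∀ {u} → Central u → Dom (d8 u)
    central-Dom (central-ε _)  = Dom-εD
    central-Dom (central-a² _) = Dom-a²D

    twist-∙ : ∀ u w → Dom (d8 u) → Dom (d8 w) → twist (u ∙ w) ≡ twist u ∙ twist w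
    twist-∙ (i , j , v) (k , l , w) p∈Dom q∈Dom = begin
      ι (δ (p ∘D q)) ∙ prodFrom m C 1 (zipWith _xor_ v w)  ≡⟨ cong₂ (λ d P → ι d ∙ P) (δ-∘ p q p∈Dom q∈Dom) (prodFrom-⊕ C-central 1 v w) ⟩
      ι (δ p ∘D δ q) ∙ (Pv ∙ Pw)                          ≡⟨ cong (_∙ (Pv ∙ Pw)) (sym (ι-∙ (δ p) (δ q))) ⟩
      (ι (δ p) ∙ ι (δ q)) ∙ (Pv ∙ Pw)                     ≡⟨ sym (interchange (ι (δ p)) Pv (ι (δ q)) Pw (prodFrom-central C-central 1 v)) ⟩
      (ι (δ p) ∙ Pv) ∙ (ι (δ q) ∙ Pw)                     ∎
      where open ≡-Reasoning
            p q : D8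
            p = i , j
            q = k , l
            Pv Pw : H m
            Pv = prodFrom m C 1 v
            Pw = prodFrom m C 1 w

    twist-ι : ∀ p → twist (ι p) ≡ ι (δ p)
    twist-ι p = trans (cong (ι (δ p) ∙_) (prodFrom-replicate C 1 (m ∸ 3))) (identityʳ (ι (δ p)))

    twist-c : ∀ k → 1 ≤ k → k ≤ m ∸ 3 → twist (c m k) ≡ C k
    twist-c (suc d) _ d<N = begin
      ι (δ εD) ∙ prodFrom m C 1 (unitVec {m ∸ 3} d)  ≡⟨ cong₂ (λ p P → ι p ∙ P) δ-εD (prodFrom-unitVec C 1 d d<N) ⟩
      ε ∙ C (d + 1)                                  ≡⟨ identityˡ (C (d + 1)) ⟩
      C (d + 1)                                      ≡⟨ cong C (ℕ.+-comm d 1) ⟩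
      C (suc d)                                      ∎
      where open ≡-Reasoning

    twist-involutive : (∀ k → 1 ≤ k → k ≤ m ∸ 3 → twist (C k) ≡ c m k) → ∀ u → Dom (d8 u) → twist (twist u) ≡ u
    twist-involutive twist-C (i , j , v) p∈Dom = begin
      twist (ι (δ p) ∙ prodFrom m C 1 v)             ≡⟨ twist-∙ (ι (δ p)) (prodFrom m C 1 v) (δ-Dom p) (central-Dom (prodFrom-central C-central 1 v)) ⟩
      twist (ι (δ p)) ∙ twist (prodFrom m C 1 v)     ≡⟨ cong₂ _∙_ (twist-ι (δ p)) (prodFrom-map C-central twist twist-central-∙ twist-ε 1 v) ⟩
      ι (δ (δ p)) ∙ prodFrom m (twist ∘ C) 1 v       ≡⟨ cong₂ (λ d P → ι d ∙ P) (δ-involutive p p∈Dom) (prodFrom-cong 1 v twist∘C≗c) ⟩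
      ι p ∙ prodFrom m (c m) 1 v                     ≡⟨ cong (ι p ∙_) (prodFrom-c v) ⟩
      ι p ∙ (εD ⋈ v)                                 ≡⟨ ι-∙-⋈ p v ⟩
      p ⋈ v                                          ∎
      where
        open ≡-Reasoning
        p : D8
        p = i , j
        twist-central-∙ : ∀ {u w} → Central u → Central w → twist (u ∙ w) ≡ twist u ∙ twist w
        twist-central-∙ {u} {w} u-central w-central = twist-∙ u w (central-Dom u-central) (central-Dom w-central)
        twist-ε : twist ε ≡ ε
        twist-ε = trans (twist-ι εD) (cong ι δ-εD)
        twist∘C≗c : ∀ k → 1 ≤ k → k < 1 + (m ∸ 3) → twist (C k) ≡ c m k
        twist∘C≗c k 1≤k (s≤s k≤N) = twist-C k 1≤k k≤N

-- The involutive automorphisms x and τ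

module Construction (n : ℕ) where

  m : ℕ
  m = suc (suc (suc n))

  open GroupH m public

  data Kind (k : ℕ) : Set where
    lastKind : isLast m k ≡ true → Kind k
    evenKind : isLast m k ≡ false → isEvenℕ k ≡ true → Kind k
    oddKind  : isLast m k ≡ false → isEvenℕ k ≡ false → Kind k

  kind : ∀ k → Kind k
  kind k with isLast m k in l | isEvenℕ k in e
  ... | true  | _     = lastKind l
  ... | false | true  = evenKind l e
  ... | false | false = oddKind l e

  xc-last : ∀ k → isLast m k ≡ true → xc m k ≡ a² m ∙ c m k
  xc-last k l rewrite l = refl

  xc-even : ∀ k → isLast m k ≡ false → isEvenℕ k ≡ true → xc m k ≡ a² m ∙ (c m (k ∸ 1) ∙ c m k)
  xc-even k l e rewrite l | e = refl

  xc-odd : ∀ k → isLast m k ≡ false → isEvenℕ k ≡ false → xc m k ≡ c m k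
  xc-odd k l e rewrite l | e = refl

  mEven≡ : mEven m ≡ not (isEvenℕ n)
  mEven≡ = not-involutive (not (isEvenℕ n))

  isLast⇒≡n×mEven : ∀ {k} → isLast m k ≡ true → k ≡ n × mEven m ≡ true
  isLast⇒≡n×mEven {k} last with mEven m | k ≡ᵇ n in k≡ᵇn
  ... | true | true = ℕ.≡ᵇ⇒≡ k n (subst T (sym k≡ᵇn) tt) , refl

  isLast⇒≡n : ∀ {k} → isLast m k ≡ true → k ≡ n
  isLast⇒≡n = proj₁ ∘ isLast⇒≡n×mEven

  isLast⇒odd : ∀ k → isLast m k ≡ true → isEvenℕ k ≡ false
  isLast⇒odd k last with isLast⇒≡n×mEven {k} last
  ... | refl , m-even = not-injective (trans (sym mEven≡) m-even)

  <n⇒¬isLast : ∀ {k} → k < n → isLast m k ≡ false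
  <n⇒¬isLast {k} k<n with isLast m k in last
  ... | false = refl
  ... | true  = ⊥-elim (ℕ.<-irrefl (isLast⇒≡n last) k<n)

  odd-¬isLast⇒<n : ∀ {k} → isEvenℕ k ≡ false → isLast m k ≡ false → k ≤ n → k < n
  odd-¬isLast⇒<n {k} odd ¬last k≤n with k ℕ.≟ n
  ... | no k≢n  = ℕ.≤∧≢⇒< k≤n k≢n
  ... | yes refl with mEven m in m-even
  ...   | true  = case trans (sym ¬last) (cong (true ∧_) (dec-true (k ℕ.≟ k) refl)) of λ ()
  ...   | false = case trans (sym (trans (sym mEven≡) m-even)) (cong not odd) of λ ()

  xc-central : ∀ k → Central (xc m k)
  xc-central k = if-central (isLast m k) (∙-central a²-central (c-central k))
                   (if-central (isEvenℕ k) (∙-central a²-central (∙-central (c-central (k ∸ 1)) (c-central k))) (c-central k))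

  module X = Twist (λ _ → ⊤) tt tt δx refl (λ _ → tt) (λ p q _ _ → δx-∘ p q) (λ p _ → δx-involutive p) (xc m) xc-central

  x≗twist : ∀ u → x m u ≡ X.twist u
  x≗twist (i , j , v) =
    trans (cong₂ (λ A B → pow m A (toℕ i) ∙ (pow m B (if j then 1 else 0) ∙ P)) (pow-ι aD 3) (ι-∙ aD bD))
          (pow-ι-∙-pow-ι (powD aD 3) (aD ∘D bD) (toℕ i) (if j then 1 else 0) P)
    where P : H m
          P = prodFrom m (xc m) 1 v

  twistx-xc : ∀ k → 1 ≤ k → k ≤ n → X.twist (xc m k) ≡ c m k
  twistx-xc k 1≤k k≤n with kind k
  ... | lastKind last = begin
    X.twist (xc m k)                   ≡⟨ cong X.twist (xc-last k last) ⟩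
    X.twist (a² m ∙ c m k)             ≡⟨ X.twist-∙ (a² m) (c m k) tt tt ⟩
    X.twist (a² m) ∙ X.twist (c m k)   ≡⟨ cong₂ _∙_ (trans (cong X.twist a²≡ι) (X.twist-ι a²D)) (trans (X.twist-c k 1≤k k≤n) (xc-last k last)) ⟩
    ι a²D ∙ (a² m ∙ c m k)             ≡⟨ cong (_∙ (a² m ∙ c m k)) (sym a²≡ι) ⟩
    a² m ∙ (a² m ∙ c m k)              ≡⟨ central-cancel a²-central (c m k) ⟩
    c m k                              ∎
    where open ≡-Reasoning
  ... | oddKind ¬last odd = trans (cong X.twist (xc-odd k ¬last odd)) (trans (X.twist-c k 1≤k k≤n) (xc-odd k ¬last odd))
  twistx-xc (suc k) 1≤k k<n | evenKind ¬last even = begin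
    X.twist (xc m (suc k))                                     ≡⟨ cong X.twist (xc-even (suc k) ¬last even) ⟩
    X.twist (a² m ∙ (c m k ∙ c m (suc k)))                     ≡⟨ X.twist-∙ (a² m) (c m k ∙ c m (suc k)) tt tt ⟩
    X.twist (a² m) ∙ X.twist (c m k ∙ c m (suc k))             ≡⟨ cong (X.twist (a² m) ∙_) (X.twist-∙ (c m k) (c m (suc k)) tt tt) ⟩
    X.twist (a² m) ∙ (X.twist (c m k) ∙ X.twist (c m (suc k))) ≡⟨ cong₂ (λ A B → A ∙ (B ∙ X.twist (c m (suc k)))) (trans (cong X.twist a²≡ι) (trans (X.twist-ι a²D) (sym a²≡ι))) xck≡ck ⟩
    a² m ∙ (c m k ∙ X.twist (c m (suc k)))                     ≡⟨ cong (λ t → a² m ∙ (c m k ∙ t)) (trans (X.twist-c (suc k) 1≤k k<n) (xc-even (suc k) ¬last even)) ⟩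
    a² m ∙ (c m k ∙ (a² m ∙ (c m k ∙ c m (suc k))))            ≡⟨ central-pair-cancel a²-central (c-central k) (c m (suc k)) ⟩
    c m (suc k)                                                ∎
    where
      open ≡-Reasoning
      odd : isEvenℕ k ≡ false
      odd = not-injective even
      xck≡ck : X.twist (c m k) ≡ c m k
      xck≡ck = trans (X.twist-c k (odd⇒≥1 odd) (ℕ.<⇒≤ k<n)) (xc-odd k (<n⇒¬isLast k<n) odd)

  x-∙ : ∀ u w → x m (u ∙ w) ≡ x m u ∙ x m w
  x-∙ u w = trans (x≗twist (u ∙ w)) (trans (X.twist-∙ u w tt tt) (sym (cong₂ _∙_ (x≗twist u) (x≗twist w))))

  x-involutive : ∀ u → x m (x m u) ≡ u
  x-involutive u = trans (trans (x≗twist (x m u)) (cong X.twist (x≗twist u))) (X.twist-involutive twistx-xc u tt)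

  τc-central : ∀ k → Central (τc m k)
  τc-central k = if-central (isLast m k) (c-central k)
    (if-central (isEvenℕ k) (∙-central (c-central (k ∸ 3)) (∙-central (c-central (k ∸ 2)) (c-central (k ∸ 1))))
                            (∙-central (c-central (k ∸ 2)) (∙-central (c-central (k ∸ 1)) (c-central (suc k)))))

  module T = Twist InK refl refl δτ refl δτ-InK δτ-∘ δτ-involutive (τc m) τc-central

  τ≗twist : ∀ u → τ m u ≡ T.twist u
  τ≗twist (i , j , v) =
    trans (cong (λ A → pow m (b m) ⌊ toℕ i /2⌋ ∙ (pow m A (if j then 1 else 0) ∙ P)) a²≡ι)
          (pow-ι-∙-pow-ι bD a²D ⌊ toℕ i /2⌋ (if j then 1 else 0) P)
    where P : H m
          P = prodFrom m (τc m) 1 v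

  τc-last : ∀ k → isLast m k ≡ true → τc m k ≡ c m k
  τc-last k l rewrite l = refl

  τc-even : ∀ k → isLast m k ≡ false → isEvenℕ k ≡ true → τc m k ≡ c m (k ∸ 3) ∙ (c m (k ∸ 2) ∙ c m (k ∸ 1))
  τc-even k l e rewrite l | e = refl

  τc-odd : ∀ k → isLast m k ≡ false → isEvenℕ k ≡ false → τc m k ≡ c m (k ∸ 2) ∙ (c m (k ∸ 1) ∙ c m (suc k))
  τc-odd k l e rewrite l | e = refl

  even⇒¬isLast : ∀ k → isEvenℕ k ≡ true → isLast m k ≡ false
  even⇒¬isLast k even with isLast m k in last
  ... | false = refl
  ... | true  = case trans (sym even) (isLast⇒odd k last) of λ ()

  twistτ-c0 : T.twist (c m 0) ≡ ε
  twistτ-c0 = trans (cong T.twist c0≡ε) (T.twist-ι εD)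

  twistτ-c-odd : ∀ k → isEvenℕ k ≡ false → k < n → T.twist (c m k) ≡ c m (k ∸ 2) ∙ (c m (k ∸ 1) ∙ c m (suc k))
  twistτ-c-odd k odd k<n = trans (T.twist-c k (odd⇒≥1 odd) (ℕ.<⇒≤ k<n)) (τc-odd k (<n⇒¬isLast k<n) odd)

  twistτ-c-even : ∀ k → isEvenℕ k ≡ true → 1 ≤ k → k ≤ n → T.twist (c m k) ≡ c m (k ∸ 3) ∙ (c m (k ∸ 2) ∙ c m (k ∸ 1))
  twistτ-c-even k even 1≤k k≤n = trans (T.twist-c k 1≤k k≤n) (τc-even k (even⇒¬isLast k even) even)

  twistτ-c∙c∙c : ∀ A B C → T.twist (c m A ∙ (c m B ∙ c m C)) ≡ T.twist (c m A) ∙ (T.twist (c m B) ∙ T.twist (c m C))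
  twistτ-c∙c∙c A B C = trans (T.twist-∙ (c m A) (c m B ∙ c m C) refl refl) (cong (T.twist (c m A) ∙_) (T.twist-∙ (c m B) (c m C) refl refl))

  twistτ-τc-odd : ∀ k → isEvenℕ k ≡ false → k < n → T.twist (c m (k ∸ 2) ∙ (c m (k ∸ 1) ∙ c m (suc k))) ≡ c m k
  twistτ-τc-odd 1 _ 1<n = begin
    T.twist (c m 0 ∙ (c m 0 ∙ c m 2))                      ≡⟨ twistτ-c∙c∙c 0 0 2 ⟩
    T.twist (c m 0) ∙ (T.twist (c m 0) ∙ T.twist (c m 2))  ≡⟨ cong₂ (λ A B → A ∙ (A ∙ B)) twistτ-c0 (twistτ-c-even 2 refl (s≤s z≤n) 1<n) ⟩
    ε ∙ (ε ∙ (c m 0 ∙ (c m 0 ∙ c m 1)))                    ≡⟨ central-cancel (central-ε _) _ ⟩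
    c m 0 ∙ (c m 0 ∙ c m 1)                                ≡⟨ central-cancel (c-central 0) (c m 1) ⟩
    c m 1                                                  ∎
    where open ≡-Reasoning
  twistτ-τc-odd k@(suc (suc K@(suc K′))) odd k<n = begin
    T.twist (c m K ∙ (c m (suc K) ∙ c m (suc k)))
      ≡⟨ twistτ-c∙c∙c K (suc K) (suc k) ⟩
    T.twist (c m K) ∙ (T.twist (c m (suc K)) ∙ T.twist (c m (suc k)))
      ≡⟨ cong₂ (λ A B → A ∙ B) (twistτ-c-odd K K-odd K<n)
               (cong₂ _∙_ (twistτ-c-even (suc K) (cong not K-odd) (s≤s z≤n) (ℕ.<⇒≤ (ℕ.<-trans (ℕ.n<1+n (suc K)) k<n)))
                          (twistτ-c-even (suc k) (cong not odd) (s≤s z≤n) k<n)) ⟩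
    (c m (K ∸ 2) ∙ (c m (K ∸ 1) ∙ c m (suc K))) ∙ ((c m (K ∸ 2) ∙ (c m (K ∸ 1) ∙ c m K)) ∙ (c m K ∙ (c m (suc K) ∙ c m k)))
      ≡⟨ c-five-term (K ∸ 2) (K ∸ 1) K (suc K) k ⟩
    c m k ∎
    where open ≡-Reasoning
          K-odd : isEvenℕ K ≡ false
          K-odd = trans (sym (isEvenℕ-+2 K)) odd
          K<n : K < n
          K<n = ℕ.<-trans (ℕ.<-trans (ℕ.n<1+n K) (ℕ.n<1+n (suc K))) k<n

  twistτ-τc-even : ∀ k → isEvenℕ k ≡ true → 1 ≤ k → k ≤ n → T.twist (c m (k ∸ 3) ∙ (c m (k ∸ 2) ∙ c m (k ∸ 1))) ≡ c m k
  twistτ-τc-even 2 _ _ 2≤n = begin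
    T.twist (c m 0 ∙ (c m 0 ∙ c m 1))                      ≡⟨ twistτ-c∙c∙c 0 0 1 ⟩
    T.twist (c m 0) ∙ (T.twist (c m 0) ∙ T.twist (c m 1))  ≡⟨ cong₂ (λ A B → A ∙ (A ∙ B)) twistτ-c0 (twistτ-c-odd 1 refl 2≤n) ⟩
    ε ∙ (ε ∙ (c m 0 ∙ (c m 0 ∙ c m 2)))                    ≡⟨ central-cancel (central-ε _) _ ⟩
    c m 0 ∙ (c m 0 ∙ c m 2)                                ≡⟨ central-cancel (c-central 0) (c m 2) ⟩
    c m 2                                                  ∎
    where open ≡-Reasoning
  twistτ-τc-even k@(suc (suc (suc K))) even _ k≤n = begin
    T.twist (c m K ∙ (c m (suc K) ∙ c m (suc (suc K))))
      ≡⟨ twistτ-c∙c∙c K (suc K) (suc (suc K)) ⟩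
    T.twist (c m K) ∙ (T.twist (c m (suc K)) ∙ T.twist (c m (suc (suc K))))
      ≡⟨ cong₂ (λ A B → A ∙ B) (twistτ-c-odd K K-odd (ℕ.<-trans (ℕ.n<1+n K) K+1<n))
               (cong₂ _∙_ (twistτ-c-even (suc K) (cong not K-odd) (s≤s z≤n) (ℕ.<⇒≤ K+1<n))
                          (twistτ-c-odd (suc (suc K)) (trans (isEvenℕ-+2 K) K-odd) k≤n)) ⟩
    (c m (K ∸ 2) ∙ (c m (K ∸ 1) ∙ c m (suc K))) ∙ ((c m (K ∸ 2) ∙ (c m (K ∸ 1) ∙ c m K)) ∙ (c m K ∙ (c m (suc K) ∙ c m k)))
      ≡⟨ c-five-term (K ∸ 2) (K ∸ 1) K (suc K) k ⟩
    c m k ∎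
    where open ≡-Reasoning
          K-odd : isEvenℕ K ≡ false
          K-odd = not-injective (trans (sym (isEvenℕ-+2 (suc K))) even)
          K+1<n : suc K < n
          K+1<n = ℕ.<-trans (ℕ.n<1+n (suc K)) k≤n

  twistτ-τc : ∀ k → 1 ≤ k → k ≤ n → T.twist (τc m k) ≡ c m k
  twistτ-τc k 1≤k k≤n with kind k
  ... | lastKind last     = trans (cong T.twist (τc-last k last)) (trans (T.twist-c k 1≤k k≤n) (τc-last k last))
  ... | evenKind ¬last even = trans (cong T.twist (τc-even k ¬last even)) (twistτ-τc-even k even 1≤k k≤n)
  ... | oddKind ¬last odd  = trans (cong T.twist (τc-odd k ¬last odd)) (twistτ-τc-odd k odd (odd-¬isLast⇒<n odd ¬last k≤n))

  inK-∙ : ∀ u w → inK m w ≡ true → inK m (u ∙ w) ≡ inK m u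
  inK-∙ u w = evenD-∘ (d8 u) (d8 w)

  inK-central : ∀ {u} → Central u → inK m u ≡ true
  inK-central = T.central-Dom

  τ-∙ : ∀ u w → inK m u ≡ true → inK m w ≡ true → τ m (u ∙ w) ≡ τ m u ∙ τ m w
  τ-∙ u w u∈K w∈K = trans (τ≗twist (u ∙ w)) (trans (T.twist-∙ u w u∈K w∈K) (sym (cong₂ _∙_ (τ≗twist u) (τ≗twist w))))

  τ-involutive : ∀ u → inK m u ≡ true → τ m (τ m u) ≡ u
  τ-involutive u u∈K = trans (trans (τ≗twist (τ m u)) (cong T.twist (τ≗twist u))) (T.twist-involutive twistτ-τc u u∈K)

  τ-inK : ∀ u → inK m (τ m u) ≡ true
  τ-inK u@(i , j , v) = trans (cong (inK m) (τ≗twist u))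
    (trans (inK-∙ (ι (δτ (i , j))) (prodFrom m (τc m) 1 v) (inK-central (prodFrom-central τc-central 1 v))) (δτ-InK (i , j)))

  -- The involutions y and z

  d8-h : d8 (h m) ≡ aD
  d8-h = cong (aD ∘D_) (d8-prodUpTo _ (λ _ → refl) ⌊ m ∸ 4 /2⌋)

  h-inK : inK m (h m) ≡ false
  h-inK = cong evenD d8-h

  h⁻¹∙-inK : ∀ u → inK m u ≡ false → inK m (h m ⁻¹ ∙ u) ≡ true
  h⁻¹∙-inK u u∉K = subst (λ p → evenD (p ∘D d8 u) ≡ true) (sym (trans (d8-inv (h m)) (cong invD d8-h))) (a⁻¹-∘-odd (d8 u) u∉K)

  cLast-central : Central (cLast m)
  cLast-central = if-central (mEven m) (c-central n) (central-ε _)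

  τ-cLast : τ m (cLast m) ≡ cLast m
  τ-cLast = τ-if (mEven m) refl
    where
      τ-if : ∀ t → mEven m ≡ t → τ m (if t then c m n else ε) ≡ (if t then c m n else ε)
      τ-if true  m-even = trans (τ≗twist (c m n)) (trans (T.twist-c n (odd⇒≥1 n-odd) ℕ.≤-refl) (τc-last n n-last))
        where
          n-odd : isEvenℕ n ≡ false
          n-odd = not-injective (trans (sym mEven≡) m-even)
          n-last : isLast m n ≡ true
          n-last = cong₂ _∧_ m-even (dec-true (n ℕ.≟ n) refl)
      τ-if false _      = trans (τ≗twist ε) (T.twist-ι εD)

  y-inK : ∀ u → inK m u ≡ true → y m u ≡ τ m u
  y-inK u = cong (if_then τ m u else h m ∙ (τ m (h m ⁻¹ ∙ u) ∙ cLast m))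

  y-∉K : ∀ u → inK m u ≡ false → y m u ≡ h m ∙ (τ m (h m ⁻¹ ∙ u) ∙ cLast m)
  y-∉K u = cong (if_then τ m u else h m ∙ (τ m (h m ⁻¹ ∙ u) ∙ cLast m))

  data Membership (u : H m) : Set where
    ∈K : inK m u ≡ true  → Membership u
    ∉K : inK m u ≡ false → Membership u

  membership : ∀ u → Membership u
  membership u with inK m u in eq
  ... | true  = ∈K eq
  ... | false = ∉K eq

  y-preserves-inK : ∀ u → inK m (y m u) ≡ inK m u
  y-preserves-inK u = go (membership u)
    where
      open ≡-Reasoning
      T₀ : H m
      T₀ = τ m (h m ⁻¹ ∙ u)
      go : Membership u → inK m (y m u) ≡ inK m u
      go (∈K u∈K) = trans (cong (inK m) (y-inK u u∈K)) (trans (τ-inK u) (sym u∈K))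
      go (∉K u∉K) = begin
        inK m (y m u)                 ≡⟨ cong (inK m) (y-∉K u u∉K) ⟩
        inK m (h m ∙ (T₀ ∙ cLast m))  ≡⟨ inK-∙ (h m) (T₀ ∙ cLast m) T₀∙cLast∈K ⟩
        inK m (h m)                   ≡⟨ trans h-inK (sym u∉K) ⟩
        inK m u                       ∎
        where T₀∙cLast∈K : inK m (T₀ ∙ cLast m) ≡ true
              T₀∙cLast∈K = trans (inK-∙ T₀ (cLast m) (inK-central cLast-central)) (τ-inK (h m ⁻¹ ∙ u))

  y-∙ : ∀ u w → inK m w ≡ true → y m (u ∙ w) ≡ y m u ∙ τ m w
  y-∙ u w w∈K = go (membership u)
    where
      open ≡-Reasoning
      T₀ : H m
      T₀ = τ m (h m ⁻¹ ∙ u)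
      go : Membership u → y m (u ∙ w) ≡ y m u ∙ τ m w
      go (∈K u∈K) = begin
        y m (u ∙ w)      ≡⟨ y-inK (u ∙ w) (trans (inK-∙ u w w∈K) u∈K) ⟩
        τ m (u ∙ w)      ≡⟨ τ-∙ u w u∈K w∈K ⟩
        τ m u ∙ τ m w    ≡⟨ cong (_∙ τ m w) (sym (y-inK u u∈K)) ⟩
        y m u ∙ τ m w    ∎
      go (∉K u∉K) = begin
        y m (u ∙ w)                                ≡⟨ y-∉K (u ∙ w) (trans (inK-∙ u w w∈K) u∉K) ⟩
        h m ∙ (τ m (h m ⁻¹ ∙ (u ∙ w)) ∙ cLast m)  ≡⟨ cong (λ t → h m ∙ (τ m t ∙ cLast m)) (sym (assoc (h m ⁻¹) u w)) ⟩
        h m ∙ (τ m ((h m ⁻¹ ∙ u) ∙ w) ∙ cLast m)  ≡⟨ cong (λ t → h m ∙ (t ∙ cLast m)) (τ-∙ (h m ⁻¹ ∙ u) w (h⁻¹∙-inK u u∉K) w∈K) ⟩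
        h m ∙ ((T₀ ∙ τ m w) ∙ cLast m)            ≡⟨ cong (h m ∙_) (central-swapʳ T₀ (τ m w) cLast-central) ⟩
        h m ∙ ((T₀ ∙ cLast m) ∙ τ m w)            ≡⟨ sym (assoc (h m) (T₀ ∙ cLast m) (τ m w)) ⟩
        (h m ∙ (T₀ ∙ cLast m)) ∙ τ m w            ≡⟨ cong (_∙ τ m w) (sym (y-∉K u u∉K)) ⟩
        y m u ∙ τ m w                              ∎

  y-involutive : ∀ u → y m (y m u) ≡ u
  y-involutive u = go (membership u)
    where
      open ≡-Reasoning
      k : H m
      k = h m ⁻¹ ∙ u
      go : Membership u → y m (y m u) ≡ u
      go (∈K u∈K) = begin
        y m (y m u)  ≡⟨ y-inK (y m u) (trans (y-preserves-inK u) u∈K) ⟩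
        τ m (y m u)  ≡⟨ cong (τ m) (y-inK u u∈K) ⟩
        τ m (τ m u)  ≡⟨ τ-involutive u u∈K ⟩
        u            ∎
      go (∉K u∉K) = begin
        y m (y m u)                                                ≡⟨ y-∉K (y m u) (trans (y-preserves-inK u) u∉K) ⟩
        h m ∙ (τ m (h m ⁻¹ ∙ y m u) ∙ cLast m)                     ≡⟨ cong (λ t → h m ∙ (τ m (h m ⁻¹ ∙ t) ∙ cLast m)) (y-∉K u u∉K) ⟩
        h m ∙ (τ m (h m ⁻¹ ∙ (h m ∙ (τ m k ∙ cLast m))) ∙ cLast m) ≡⟨ cong (λ t → h m ∙ (τ m t ∙ cLast m)) (\\-leftDividesʳ (h m) (τ m k ∙ cLast m)) ⟩
        h m ∙ (τ m (τ m k ∙ cLast m) ∙ cLast m)                    ≡⟨ cong (λ t → h m ∙ (t ∙ cLast m)) (τ-∙ (τ m k) (cLast m) (τ-inK k) (inK-central cLast-central)) ⟩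
        h m ∙ ((τ m (τ m k) ∙ τ m (cLast m)) ∙ cLast m)            ≡⟨ cong₂ (λ A B → h m ∙ ((A ∙ B) ∙ cLast m)) (τ-involutive k (h⁻¹∙-inK u u∉K)) τ-cLast ⟩
        h m ∙ ((k ∙ cLast m) ∙ cLast m)                            ≡⟨ cong (h m ∙_) (central-cancelʳ cLast-central k) ⟩
        h m ∙ (h m ⁻¹ ∙ u)                                         ≡⟨ \\-leftDividesˡ (h m) u ⟩
        u                                                          ∎

  h⁻¹cLast : H m
  h⁻¹cLast = h m ⁻¹ ∙ cLast m

  h⁻¹cLast∙h : h⁻¹cLast ∙ h m ≡ cLast m
  h⁻¹cLast∙h = begin
    (h m ⁻¹ ∙ cLast m) ∙ h m  ≡⟨ central-swapʳ (h m ⁻¹) (h m) cLast-central ⟨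
    (h m ⁻¹ ∙ h m) ∙ cLast m  ≡⟨ cong (_∙ cLast m) (inverseˡ (h m)) ⟩
    ε ∙ cLast m               ≡⟨ identityˡ (cLast m) ⟩
    cLast m                   ∎
    where open ≡-Reasoning

  h⁻¹cLast∙h∙ : ∀ t → h⁻¹cLast ∙ (h m ∙ (t ∙ cLast m)) ≡ t
  h⁻¹cLast∙h∙ t = begin
    h⁻¹cLast ∙ (h m ∙ (t ∙ cLast m))  ≡⟨ assoc h⁻¹cLast (h m) (t ∙ cLast m) ⟨
    (h⁻¹cLast ∙ h m) ∙ (t ∙ cLast m)  ≡⟨ cong (_∙ (t ∙ cLast m)) h⁻¹cLast∙h ⟩
    cLast m ∙ (t ∙ cLast m)           ≡⟨ central-comm cLast-central (t ∙ cLast m) ⟨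
    (t ∙ cLast m) ∙ cLast m           ≡⟨ central-cancelʳ cLast-central t ⟩
    t                                 ∎
    where open ≡-Reasoning

  z-involutive : ∀ w → z m (z m w) ≡ w
  z-involutive w = begin
    y m ((y m (w ∙ h m) ∙ h⁻¹cLast) ∙ h m) ∙ h⁻¹cLast  ≡⟨ cong (λ t → y m t ∙ h⁻¹cLast) (assoc (y m (w ∙ h m)) h⁻¹cLast (h m)) ⟩
    y m (y m (w ∙ h m) ∙ (h⁻¹cLast ∙ h m)) ∙ h⁻¹cLast  ≡⟨ cong (λ t → y m (y m (w ∙ h m) ∙ t) ∙ h⁻¹cLast) h⁻¹cLast∙h ⟩
    y m (y m (w ∙ h m) ∙ cLast m) ∙ h⁻¹cLast           ≡⟨ cong (_∙ h⁻¹cLast) (y-∙ (y m (w ∙ h m)) (cLast m) (inK-central cLast-central)) ⟩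
    (y m (y m (w ∙ h m)) ∙ τ m (cLast m)) ∙ h⁻¹cLast   ≡⟨ cong₂ (λ A B → (A ∙ B) ∙ h⁻¹cLast) (y-involutive (w ∙ h m)) τ-cLast ⟩
    ((w ∙ h m) ∙ cLast m) ∙ (h m ⁻¹ ∙ cLast m)         ≡⟨ cong (_∙ (h m ⁻¹ ∙ cLast m)) (central-swapʳ w (h m) cLast-central) ⟩
    ((w ∙ cLast m) ∙ h m) ∙ (h m ⁻¹ ∙ cLast m)         ≡⟨ assoc (w ∙ cLast m) (h m) (h m ⁻¹ ∙ cLast m) ⟩
    (w ∙ cLast m) ∙ (h m ∙ (h m ⁻¹ ∙ cLast m))         ≡⟨ cong ((w ∙ cLast m) ∙_) (\\-leftDividesˡ (h m) (cLast m)) ⟩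
    (w ∙ cLast m) ∙ cLast m                            ≡⟨ central-cancelʳ cLast-central w ⟩
    w                                                  ∎
    where open ≡-Reasoning

  ConjugateInS : (H m → H m) → H m → Set
  ConjugateInS s q = Σ (H m → H m) λ s′ → InS m s′ × (∀ w → s (w ∙ q) ≡ s′ w ∙ s q)

  x-conjugate : ∀ q → ConjugateInS (x m) q
  x-conjugate q = x m , inj₁ (λ _ → refl) , λ w → x-∙ w q

  y-conjugate : ∀ q → ConjugateInS (y m) q
  y-conjugate q = go (membership q)
    where
      k : H m
      k = h m ⁻¹ ∙ q
      go : Membership q → ConjugateInS (y m) q
      go (∈K q∈K) = y m , inj₂ (inj₁ (λ _ → refl)) , λ w → trans (y-∙ w q q∈K) (cong (y m w ∙_) (sym (y-inK q q∈K)))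
      go (∉K q∉K) = z m , inj₂ (inj₂ (λ _ → refl)) , λ w → begin
        y m (w ∙ q)                                          ≡⟨ cong (y m) (cong (w ∙_) (\\-leftDividesˡ (h m) q)) ⟨
        y m (w ∙ (h m ∙ k))                                  ≡⟨ cong (y m) (assoc w (h m) k) ⟨
        y m ((w ∙ h m) ∙ k)                                  ≡⟨ y-∙ (w ∙ h m) k (h⁻¹∙-inK q q∉K) ⟩
        y m (w ∙ h m) ∙ τ m k                                ≡⟨ cong (y m (w ∙ h m) ∙_) (h⁻¹cLast∙h∙ (τ m k)) ⟨
        y m (w ∙ h m) ∙ (h⁻¹cLast ∙ (h m ∙ (τ m k ∙ cLast m))) ≡⟨ assoc (y m (w ∙ h m)) h⁻¹cLast (h m ∙ (τ m k ∙ cLast m)) ⟨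
        z m w ∙ (h m ∙ (τ m k ∙ cLast m))                    ≡⟨ cong (z m w ∙_) (y-∉K q q∉K) ⟨
        z m w ∙ y m q                                        ∎
        where open ≡-Reasoning

  z-conjugate : ∀ q → ConjugateInS (z m) q
  z-conjugate q = from-y (y-conjugate (q ∙ h m))
    where
      open ≡-Reasoning
      from-y : ConjugateInS (y m) (q ∙ h m) → ConjugateInS (z m) q
      from-y (s′ , s′∈S , y-shift) = s′ , s′∈S , λ w → begin
        y m ((w ∙ q) ∙ h m) ∙ h⁻¹cLast      ≡⟨ cong (λ t → y m t ∙ h⁻¹cLast) (assoc w q (h m)) ⟩
        y m (w ∙ (q ∙ h m)) ∙ h⁻¹cLast      ≡⟨ cong (_∙ h⁻¹cLast) (y-shift w) ⟩
        (s′ w ∙ y m (q ∙ h m)) ∙ h⁻¹cLast   ≡⟨ assoc (s′ w) (y m (q ∙ h m)) h⁻¹cLast ⟩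
        s′ w ∙ z m q                        ∎

  conjugate-resp : ∀ {s s₀ q} → s ≈ₚ s₀ → ConjugateInS s₀ q → ConjugateInS s q
  conjugate-resp {s} {s₀} {q} s≈s₀ (s′ , s′∈S , s₀-shift) =
    s′ , s′∈S , λ w → trans (s≈s₀ (w ∙ q)) (trans (s₀-shift w) (cong (s′ w ∙_) (sym (s≈s₀ q))))

  S-conjugate : ∀ {s} → InS m s → ∀ q → ConjugateInS s q
  S-conjugate (inj₁ s≈x)        q = conjugate-resp s≈x (x-conjugate q)
  S-conjugate (inj₂ (inj₁ s≈y)) q = conjugate-resp s≈y (y-conjugate q)
  S-conjugate (inj₂ (inj₂ s≈z)) q = conjugate-resp s≈z (z-conjugate q)

  S-involutive : ∀ {s} → InS m s → ∀ w → s (s w) ≡ w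
  S-involutive (inj₁ s≈x)        w = trans (s≈x _) (trans (cong (x m) (s≈x w)) (x-involutive w))
  S-involutive (inj₂ (inj₁ s≈y)) w = trans (s≈y _) (trans (cong (y m) (s≈y w)) (y-involutive w))
  S-involutive (inj₂ (inj₂ s≈z)) w = trans (s≈z _) (trans (cong (z m) (s≈z w)) (z-involutive w))

  -- Γ_m is isomorphic to the Cayley graph

  module Perm = Transpositions (_≟H_ m)

  R-even : ∀ k → EvenH m (R m k)
  R-even = translations-even n

  fixes-only-ε : ∀ (g : AltH* m) {u} → proj₁ g u ≡ ε → u ≡ ε
  fixes-only-ε (g , g-even , g-ε) gu≡ε = Perm.even-injective g-even (trans gu≡ε (sym g-ε))

  translated-edge⇒cayAdj : ∀ (u v : AltH* m) {t} → InS m t → ∀ k₁ r k′ →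
                           (∀ w → proj₁ v (w ∙ k′) ≡ proj₁ u (t (w ∙ k₁) ∙ r)) → CayAdj m u v
  translated-edge⇒cayAdj u@(u⁺ , _ , _) v@(v⁺ , _ , v-ε) {t} t∈S k₁ r k′ v≈u∘t = s′ , s′∈S , λ w → begin
    v⁺ w                               ≡⟨ cong v⁺ (//-rightDividesˡ k′ w) ⟨
    v⁺ ((w ∙ k′ ⁻¹) ∙ k′)              ≡⟨ v≈u∘t (w ∙ k′ ⁻¹) ⟩
    u⁺ (t ((w ∙ k′ ⁻¹) ∙ k₁) ∙ r)      ≡⟨ cong₂ (λ A B → u⁺ (t A ∙ B)) (assoc w (k′ ⁻¹) k₁) r≡[tq]⁻¹ ⟩
    u⁺ (t (w ∙ q) ∙ t q ⁻¹)            ≡⟨ cong (λ A → u⁺ (A ∙ t q ⁻¹)) (t-shift w) ⟩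
    u⁺ ((s′ w ∙ t q) ∙ t q ⁻¹)         ≡⟨ cong u⁺ (//-rightDividesʳ (t q) (s′ w)) ⟩
    u⁺ (s′ w)                          ∎
    where
      open ≡-Reasoning
      q : H m
      q = k′ ⁻¹ ∙ k₁
      conj : ConjugateInS t q
      conj = S-conjugate t∈S q
      s′ : H m → H m
      s′ = proj₁ conj
      s′∈S : InS m s′
      s′∈S = proj₁ (proj₂ conj)
      t-shift : ∀ w → t (w ∙ q) ≡ s′ w ∙ t q
      t-shift = proj₂ (proj₂ conj)
      r≡[tq]⁻¹ : r ≡ t q ⁻¹
      r≡[tq]⁻¹ = inverseʳ-unique (t q) r (fixes-only-ε u (begin
        u⁺ (t q ∙ r)                    ≡⟨ cong (λ A → u⁺ (t (A ∙ k₁) ∙ r)) (identityˡ (k′ ⁻¹)) ⟨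
        u⁺ (t ((ε ∙ k′ ⁻¹) ∙ k₁) ∙ r)   ≡⟨ v≈u∘t (ε ∙ k′ ⁻¹) ⟨
        v⁺ ((ε ∙ k′ ⁻¹) ∙ k′)           ≡⟨ cong v⁺ (//-rightDividesˡ k′ ε) ⟩
        v⁺ ε                            ≡⟨ v-ε ⟩
        ε                               ∎))

  sameCoset-refl : ∀ f → SameCoset m f f
  sameCoset-refl f = ε , λ w → cong f (sym (identityʳ w))

  S⊆LSL : ∀ {s} → InS m s → InLSL m s
  S⊆LSL (inj₁ s≈x)        = ε , ε , x m , inj₁ (λ _ → refl) , λ w → trans (s≈x w) (sym (trans (identityʳ _) (cong (x m) (identityʳ w))))
  S⊆LSL (inj₂ (inj₁ s≈y)) = ε , ε , y m , inj₂ (λ _ → refl) , λ w → trans (s≈y w) (sym (trans (identityʳ _) (cong (y m) (identityʳ w))))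
  S⊆LSL (inj₂ (inj₂ s≈z)) = h m , h⁻¹cLast , y m , inj₂ (λ _ → refl) , s≈z

  cayley⇒coset-edge : ∀ u v → CayAdj m u v → ΓAdj m (toCoset m u) (toCoset m v)
  cayley⇒coset-edge u v (s , s∈S , v≈s∘u) =
    toCoset m u , s , S⊆LSL s∈S , inj₁ (sameCoset-refl (proj₁ u) , (ε , λ w → trans (sym (v≈s∘u w)) (cong (proj₁ v) (sym (identityʳ w)))))

  xy⊆S : ∀ {t} → (t ≈ₚ x m) ⊎ (t ≈ₚ y m) → InS m t
  xy⊆S (inj₁ t≈x) = inj₁ t≈x
  xy⊆S (inj₂ t≈y) = inj₂ (inj₁ t≈y)

  cayAdj-sym : ∀ u v → CayAdj m u v → CayAdj m v u
  cayAdj-sym (u⁺ , _) (v⁺ , _) (s , s∈S , v≈s∘u) =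
    s , s∈S , λ w → trans (cong u⁺ (sym (S-involutive s∈S w))) (sym (v≈s∘u (s w)))

  coset⇒cayley-edge : ∀ u v → ΓAdj m (toCoset m u) (toCoset m v) → CayAdj m u v
  coset⇒cayley-edge u v (_ , s , (k₁ , k₂ , t , t∈xy , s≈) , inj₁ ((k , g≈u) , (k′ , sg≈v))) =
    translated-edge⇒cayAdj u v (xy⊆S t∈xy) k₁ (k₂ ∙ k) k′ λ w →
      trans (sym (sg≈v w)) (trans (g≈u (s w)) (cong (proj₁ u) (trans (cong (_∙ k) (s≈ w)) (assoc (t (w ∙ k₁)) k₂ k))))
  coset⇒cayley-edge u v (_ , s , (k₁ , k₂ , t , t∈xy , s≈) , inj₂ ((k , g≈v) , (k′ , sg≈u))) =
    cayAdj-sym v u (translated-edge⇒cayAdj v u (xy⊆S t∈xy) k₁ (k₂ ∙ k) k′ λ w →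
      trans (sym (sg≈u w)) (trans (g≈v (s w)) (cong (proj₁ v) (trans (cong (_∙ k) (s≈ w)) (assoc (t (w ∙ k₁)) k₂ k)))))

  toCoset-injective : ∀ u v → _≈Γ_ m (toCoset m u) (toCoset m v) → _≈*_ m u v
  toCoset-injective u@(u⁺ , _ , _) (v⁺ , _ , v-ε) (k , v≈u∘Rk) w = sym (begin
    v⁺ w        ≡⟨ v≈u∘Rk w ⟩
    u⁺ (w ∙ k)  ≡⟨ cong (λ t → u⁺ (w ∙ t)) k≡ε ⟩
    u⁺ (w ∙ ε)  ≡⟨ cong u⁺ (identityʳ w) ⟩
    u⁺ w        ∎)
    where
      open ≡-Reasoning
      k≡ε : k ≡ ε
      k≡ε = fixes-only-ε u (trans (cong u⁺ (sym (identityˡ k))) (trans (sym (v≈u∘Rk ε)) v-ε))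

  toCoset-surjective : ∀ W → ∃ λ v → _≈Γ_ m (toCoset m v) W
  toCoset-surjective (W , W-even) = (R m p ·ₚ W , even-· (_≟H_ m) (R-even p) W-even , fixes-ε) ,
                                    p ⁻¹ , λ w → cong W (sym (//-rightDividesˡ p w))
    where
      p : H m
      p = Perm.preimage W-even ε
      fixes-ε : W (ε ∙ p) ≡ ε
      fixes-ε = trans (cong W (identityˡ p)) (Perm.preimage-section W-even ε)

  toCoset-iso : IsGraphIso (_≈*_ m) (_≈Γ_ m) (CayAdj m) (ΓAdj m) (toCoset m)
  toCoset-iso = record
    { well-defined = λ {u} {v} u≈v → ε , λ w → trans (sym (u≈v w)) (cong (proj₁ u) (sym (identityʳ w)))
    ; injective    = λ {u} {v} → toCoset-injective u v
    ; surjective   = toCoset-surjective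
    ; adj-to       = cayley⇒coset-edge
    ; adj-from     = coset⇒cayley-edge
    }

  -- An automorphism that does not normalise the regular representation

  preimage-a² : AltH* m → H m
  preimage-a² (_ , V-even , _) = Perm.preimage V-even (a² m)

  preimage-a²-section : ∀ (V : AltH* m) → proj₁ V (preimage-a² V) ≡ a² m
  preimage-a²-section (_ , V-even , _) = Perm.preimage-section V-even (a² m)

  opaque
    φ : AltH* m → AltH* m
    φ V@(V⁺ , V-even , _) = (λ u → V⁺ (u ∙ k) ∙ a² m) , even-· (_≟H_ m) (even-· (_≟H_ m) (R-even k) V-even) (R-even (a² m)) , fixes-ε
      where
        k : H m
        k = preimage-a² V
        fixes-ε : V⁺ (ε ∙ k) ∙ a² m ≡ ε
        fixes-ε = trans (cong (λ t → V⁺ t ∙ a² m) (identityˡ k)) (trans (cong (_∙ a² m) (preimage-a²-section V)) (central-square a²-central))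

    φ-char : ∀ (V : AltH* m) k → proj₁ V k ≡ a² m → ∀ u → proj₁ (φ V) u ≡ proj₁ V (u ∙ k) ∙ a² m
    φ-char V@(V⁺ , V-even , _) k Vk≡a² u =
      cong (λ t → V⁺ (u ∙ t) ∙ a² m) (Perm.even-injective V-even (trans (preimage-a²-section V) (sym Vk≡a²)))

  φ-char′ : ∀ (V : AltH* m) u → proj₁ (φ V) u ≡ proj₁ V (u ∙ preimage-a² V) ∙ a² m
  φ-char′ V = φ-char V (preimage-a² V) (preimage-a²-section V)

  φ-involutive : ∀ (V : AltH* m) → _≈*_ m (φ (φ V)) V
  φ-involutive V@(V⁺ , _) w = begin
    proj₁ (φ (φ V)) w                  ≡⟨ φ-char′ (φ V) w ⟩
    proj₁ (φ V) (w ∙ k′) ∙ a² m        ≡⟨ cong (_∙ a² m) (φ-char′ V (w ∙ k′)) ⟩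
    (V⁺ ((w ∙ k′) ∙ k) ∙ a² m) ∙ a² m  ≡⟨ central-cancelʳ a²-central _ ⟩
    V⁺ ((w ∙ k′) ∙ k)                  ≡⟨ cong V⁺ (trans (assoc w k′ k) (trans (cong (w ∙_) k′k≡ε) (identityʳ w))) ⟩
    V⁺ w                               ∎
    where
      open ≡-Reasoning
      k k′ : H m
      k  = preimage-a² V
      k′ = preimage-a² (φ V)
      k′k≡ε : k′ ∙ k ≡ ε
      k′k≡ε = fixes-only-ε V (begin
        V⁺ (k′ ∙ k)                  ≡⟨ central-cancelʳ a²-central (V⁺ (k′ ∙ k)) ⟨
        (V⁺ (k′ ∙ k) ∙ a² m) ∙ a² m  ≡⟨ cong (_∙ a² m) (φ-char′ V k′) ⟨
        proj₁ (φ V) k′ ∙ a² m        ≡⟨ cong (_∙ a² m) (preimage-a²-section (φ V)) ⟩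
        a² m ∙ a² m                  ≡⟨ central-square a²-central ⟩
        ε                            ∎)

  φ-cong : ∀ {u v} → _≈*_ m u v → _≈*_ m (φ u) (φ v)
  φ-cong {u} {v} u≈v w = begin
    proj₁ (φ u) w                      ≡⟨ φ-char′ u w ⟩
    proj₁ u (w ∙ preimage-a² u) ∙ a² m  ≡⟨ cong (_∙ a² m) (u≈v (w ∙ preimage-a² u)) ⟩
    proj₁ v (w ∙ preimage-a² u) ∙ a² m  ≡⟨ φ-char v (preimage-a² u) (trans (sym (u≈v _)) (preimage-a²-section u)) w ⟨
    proj₁ (φ v) w                      ∎
    where open ≡-Reasoning

  φ-adj : ∀ (u v : AltH* m) → CayAdj m u v → CayAdj m (φ u) (φ v)
  φ-adj u@(u⁺ , u-even , _) v@(v⁺ , _) (s , s∈S , v≈s∘u) = s′ , s′∈S , λ w → begin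
    proj₁ (φ v) w                ≡⟨ φ-char′ v w ⟩
    v⁺ (w ∙ kv) ∙ a² m           ≡⟨ cong (_∙ a² m) (v≈s∘u (w ∙ kv)) ⟩
    u⁺ (s (w ∙ kv)) ∙ a² m       ≡⟨ cong (λ t → u⁺ t ∙ a² m) (trans (s-shift w) (cong (s′ w ∙_) s-kv≡ku)) ⟩
    u⁺ (s′ w ∙ ku) ∙ a² m        ≡⟨ φ-char′ u (s′ w) ⟨
    proj₁ (φ u) (s′ w)           ∎
    where
      open ≡-Reasoning
      ku kv : H m
      ku = preimage-a² u
      kv = preimage-a² v
      conj : ConjugateInS s kv
      conj = S-conjugate s∈S kv
      s′ : H m → H m
      s′ = proj₁ conj
      s′∈S : InS m s′
      s′∈S = proj₁ (proj₂ conj)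
      s-shift : ∀ w → s (w ∙ kv) ≡ s′ w ∙ s kv
      s-shift = proj₂ (proj₂ conj)
      s-kv≡ku : s kv ≡ ku
      s-kv≡ku = Perm.even-injective u-even (trans (sym (v≈s∘u kv)) (trans (preimage-a²-section v) (sym (preimage-a²-section u))))

  cayAdj-resp : ∀ {u u′ v v′ : AltH* m} → _≈*_ m u u′ → _≈*_ m v v′ → CayAdj m u v → CayAdj m u′ v′
  cayAdj-resp u≈u′ v≈v′ (s , s∈S , v≈s∘u) = s , s∈S , λ w → trans (sym (v≈v′ w)) (trans (v≈s∘u w) (u≈u′ (s w)))

  φ-automorphism : IsAutomorphism (_≈*_ m) (CayAdj m) φ φ
  φ-automorphism = record
    { cong-φ   = φ-cong
    ; cong-φ⁻¹ = φ-cong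
    ; inverseˡ = φ-involutive
    ; inverseʳ = φ-involutive
    ; adj-to   = φ-adj
    ; adj-from = λ u v φu~φv → cayAdj-resp {φ (φ u)} {u} {φ (φ v)} {v} (φ-involutive u) (φ-involutive v) (φ-adj (φ u) (φ v) φu~φv)
    }

  ActsVia : AltH* m → (D8 → D8) → Set
  ActsVia V σ = ∀ r → proj₁ V (ι r) ≡ ι (σ r)

  module ι-Transport = Transport _≟D8_ (_≟H_ m) ι ι-injective

  liftD8 : (ps : List (Transposition _≟D8_ × Transposition _≟D8_)) → applyPairs _≟D8_ ps εD ≡ εD → AltH* m
  liftD8 ps fixes-εD = applyPairs (_≟H_ m) (ι-Transport.mapPairs ps) , (ι-Transport.mapPairs ps , λ _ → refl) ,
                       trans (ι-Transport.applyPairs-map ps εD) (cong ι fixes-εD)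

  liftD8-acts : ∀ ps fixes-εD → ActsVia (liftD8 ps fixes-εD) (applyPairs _≟D8_ ps)
  liftD8-acts ps _ = ι-Transport.applyPairs-map ps

  idAlt : AltH* m
  idAlt = (λ u → u) , ([] , λ _ → refl) , refl

  ρ-acts : ∀ {g V σ σ′} → ActsVia g σ → ActsVia V σ′ → ActsVia (ρ m g V) (σ ∘ σ′)
  ρ-acts {g} {V} {σ′ = σ′} g-acts V-acts r = trans (cong (proj₁ g) (V-acts r)) (g-acts (σ′ r))

  φ-acts : ∀ {V σ} k → ActsVia V σ → σ k ≡ a²D → ActsVia (φ V) (λ r → σ (r ∘D k) ∘D a²D)
  φ-acts {V} {σ} k V-acts σk≡a² r = begin
    proj₁ (φ V) (ι r)             ≡⟨ φ-char V (ι k) (trans (V-acts k) (trans (cong ι σk≡a²) (sym a²≡ι))) (ι r) ⟩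
    proj₁ V (ι r ∙ ι k) ∙ a² m    ≡⟨ cong₂ (λ t A → proj₁ V t ∙ A) (ι-∙ r k) a²≡ι ⟩
    proj₁ V (ι (r ∘D k)) ∙ ι a²D  ≡⟨ cong (_∙ ι a²D) (V-acts (r ∘D k)) ⟩
    ι (σ (r ∘D k)) ∙ ι a²D        ≡⟨ ι-∙ (σ (r ∘D k)) a²D ⟩
    ι (σ (r ∘D k) ∘D a²D)         ∎
    where open ≡-Reasoning

  -- the 3-cycles (b a a²) and (b a ab) of D₈
  g₀-pairs v₁-pairs : List (Transposition _≟D8_ × Transposition _≟D8_)
  g₀-pairs = ((bD , aD , λ ()) , (bD , a²D , λ ())) ∷ []
  v₁-pairs = ((bD , aD , λ ()) , (bD , abD , λ ())) ∷ []

  g₀ v₁ : AltH* m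
  g₀ = liftD8 g₀-pairs refl
  v₁ = liftD8 v₁-pairs refl

  not-normal : ¬ IsNormalCay m
  not-normal normal = case ι-injective (begin
    ι (σ₁ bD)                                 ≡⟨ φQ-acts bD ⟨
    proj₁ (φ (ρ m g₀ (φ v₁))) (ι bD)          ≡⟨ g′-spec v₁ (ι bD) ⟩
    proj₁ g′ (proj₁ v₁ (ι bD))                ≡⟨ cong (proj₁ g′) (liftD8-acts v₁-pairs refl bD) ⟩
    proj₁ g′ (ι (σv bD))                      ≡⟨ g′-spec idAlt (ι (σv bD)) ⟨
    proj₁ (φ (ρ m g₀ (φ idAlt))) (ι (σv bD))  ≡⟨ φP-acts (σv bD) ⟩
    ι (σ₀ (σv bD))                            ∎) of λ ()
    where
      open ≡-Reasoning
      σg σv σ₀ σ₁ : D8 → D8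
      σg = applyPairs _≟D8_ g₀-pairs
      σv = applyPairs _≟D8_ v₁-pairs
      σ₀ r = σg (((r ∘D aD) ∘D a²D) ∘D a²D) ∘D a²D
      σ₁ r = σg (σv ((r ∘D aD) ∘D a²D) ∘D a²D) ∘D a²D
      g₀-acts : ActsVia g₀ σg
      g₀-acts = liftD8-acts g₀-pairs refl
      φP-acts : ActsVia (φ (ρ m g₀ (φ idAlt))) σ₀
      φP-acts = φ-acts aD (ρ-acts {g₀} {φ idAlt} g₀-acts (φ-acts {idAlt} a²D (λ _ → refl) refl)) refl
      φQ-acts : ActsVia (φ (ρ m g₀ (φ v₁))) σ₁
      φQ-acts = φ-acts aD (ρ-acts {g₀} {φ v₁} g₀-acts (φ-acts {v₁} a²D (liftD8-acts v₁-pairs refl) refl)) refl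
      g′ : AltH* m
      g′ = proj₁ (normal φ φ φ-automorphism g₀)
      g′-spec : ∀ v → _≈*_ m (φ (ρ m g₀ (φ v))) (ρ m g′ v)
      g′-spec = proj₂ (normal φ φ φ-automorphism g₀)

lemma4p2 : (m : ℕ) → 4 ≤ m →
    (¬ IsNormalCay m)
    × IsGraphIso (_≈*_ m) (_≈Γ_ m) (CayAdj m) (ΓAdj m) (toCoset m)
-- The construction works for every m ≥ 3; the hypothesis only rules out m < 3.
lemma4p2 (suc (suc (suc n))) _ = not-normal , toCoset-iso
  where open Construction n
lemma4p2 (suc zero)       (s≤s ())
lemma4p2 (suc (suc zero)) (s≤s (s≤s ()))
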